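{- Let $k$ be a positive integer. For an integer $n\ge 0$, let $R_k(n)$ denote the number of partitions of $n$ whose Durfee triangle has size $k$. Then \[ \mathcal{F}_k(q):=\sum_{n=0}^{\infty} R_k(n)\,q^n=\frac{q^{k(k+1)/2}\,\varphi_k(q)}{(1-q)(1-q^2)\cdots(1-q^k)}, \] where \[ \varphi_k(q)=1+c_1q+\cdots+c_{k^2-1}q^{k^2-1}+(-1)^{k-1}q^{k^2} \] is a polynomial of degree $k^2$ with integer coefficients $c_1,\dots,c_{k^2-1}$. Moreover, if $k$ is odd then $\varphi_k(-1)=0$.
   Context: A partition of $n\ge 0$ is a tuple $\lambda=(\lambda_1,\dots,\lambda_d)$ of integers $\lambda_1\ge\cdots\ge\lambda_d\ge 1$ with sum $n$; set $\lambda_j=0$ for $j>d$. The Durfee triangle of $\lambda$ has size $k$ if $k$ is the largest integer such that $\lambda_j>k-j$ for all $j\in\{1,2,\dots,k\}$ (equivalently, the largest right isosceles triangle with apex at the top-left corner fitting in the Ferrers board has horizontal and vertical sides of length $k$). -}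

module Defs where

open import Data.Nat as ℕ using (ℕ; zero; suc; _<_; _≤_; _∸_; _<ᵇ_)
open import Data.Integer as ℤ using (ℤ; +_; -1ℤ; 1ℤ; 0ℤ)
open import Data.List using (List; []; _∷_; length)
open import Data.Nat.ListAction using (sum)
open import Data.List.Relation.Unary.All using (All)
open import Data.List.Relation.Binary.Pointwise using ()
open import Data.List.Relation.Unary.Linked using (Linked)
open import Data.List.Relation.Unary.Unique.Propositional using (Unique)
open import Data.List.Membership.Propositional using (_∈_)
open import Data.Product using (Σ; _×_)
open import Data.Bool using (if_then_else_)
open import Function.Bundles using (_⇔_)
open import Relation.Binary.PropositionalEquality using (_≡_)

IsPartition : ℕ → List ℕ → Set
IsPartition n λs = Linked (λ a b → b ≤ a) λs × All (λ a → 1 ≤ a) λs × sum λs ≡ n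

-- part λ j = λ_j (1-indexed), with λ_j = 0 for j > d (and for j = 0, unused).
part : List ℕ → ℕ → ℕ
part [] _ = 0
part (x ∷ xs) zero = 0
part (x ∷ xs) (suc zero) = x
part (x ∷ xs) (suc (suc j)) = part xs (suc j)

TriangleFits : List ℕ → ℕ → Set
TriangleFits λs k = ∀ j → 1 ≤ j → j ≤ k → k ∸ j < part λs j

DurfeeTriangleSize : List ℕ → ℕ → Set
DurfeeTriangleSize λs k = TriangleFits λs k × (∀ m → TriangleFits λs m → m ≤ k)

HasCard : {A : Set} → (A → Set) → ℕ → Set
HasCard {A} P c = Σ (List A) λ xs → Unique xs × (∀ x → (x ∈ xs) ⇔ P x) × length xs ≡ c

Series : Set
Series = ℕ → ℤ

sumTo : ℕ → (ℕ → ℤ) → ℤ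
sumTo zero f = f 0
sumTo (suc n) f = sumTo n f ℤ.+ f (suc n)

_⊛_ : Series → Series → Series
(f ⊛ g) n = sumTo n (λ m → f m ℤ.* g (n ∸ m))

oneS : Series
oneS zero = 1ℤ
oneS (suc _) = 0ℤ

oneMinusQ^ : ℕ → Series
oneMinusQ^ i n = oneS n ℤ.- (if n ℕ.≡ᵇ i then 1ℤ else 0ℤ)

den : ℕ → Series
den zero = oneS
den (suc k) = den k ⊛ oneMinusQ^ (suc k)

shift : ℕ → Series → Series
shift t f n = if n <ᵇ t then 0ℤ else f (n ∸ t)

{-# OPTIONS --safe #-}
-- A partition whose Durfee triangle has size k = a + b splits, for a unique a ≤ k, into its first
-- a parts, all larger than b, and the remaining parts, all at most b.  Removing b + 1 cells from
-- each of the first a parts leaves a partition γ into exactly a parts (zeros allowed) containing a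
-- triangle of size a; the rest is a partition β with parts in [1, b] containing a triangle of
-- size b.  So F_k = Σ_a q^(a(b+1)) G_a C_b.  Both families, with parameters (m, r) for "exactly m
-- parts" resp. "parts ≤ m" and "contains a triangle of size r", obey
-- Y(m+1, r) = Y(m, r) + q^(m+1) Y(m+1, r-1), which forces Y(m, r) (q;q)_m = q^(r(r+1)/2) e(m, r)
-- for polynomials e(m, r) = numerator m r; e(m, m) has degree m(m-1) and leading coefficient
-- (-1)^(m-1).  As (q;q)_k = (q;q)_a (q;q)_b [k choose a]_q,
--   F_k (q;q)_k = q^(k(k+1)/2) Σ_a q^a e(a, a) e(b, b) [k choose a]_q,
-- and the sum is φ_k.  Its summand of index a has degree a + a(a-1) + b(b-1) + ab ≤ k², with
-- equality only for a = k, and is symmetric in a and b apart from the factor q^a; for odd k the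
-- summands of index a and k - a therefore cancel at q = -1.
module Submission where

open import Defs
open import Data.Nat using (ℕ; suc; _*_; _<_; _≤_; _∸_; _%_; _/_)
open import Data.Integer using (ℤ; +_; -1ℤ; 1ℤ; 0ℤ; _^_) renaming (_*_ to _*ℤ_)
open import Data.List using (List)
open import Data.Product using (Σ; _×_)
open import Relation.Binary.PropositionalEquality using (_≡_)

open import Algebra.Bundles using (CommutativeMonoid)
open import Relation.Binary.Bundles using (Setoid)
open import Data.Bool using (true; false; if_then_else_)
open import Data.Empty using (⊥; ⊥-elim)
open import Data.Unit using (⊤; tt)
open import Data.Integer using () renaming (_+_ to _+ℤ_; -_ to -ℤ_)
import Data.Integer.Properties as ℤₚ
open import Data.Integer.Tactic.RingSolver using (solve-∀)
open import Data.Nat using (zero; _+_; z≤n; s≤s; _<ᵇ_; _≤ᵇ_; _≡ᵇ_; _≤?_; _<?_; _≟_)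
import Data.Nat.DivMod as ℕ-DivMod
open import Data.Nat.Induction using (<-rec)
import Data.Nat.Properties as ℕₚ
import Data.Nat.Tactic.RingSolver as ℕ-Solver
open import Data.Product using (_,_; proj₁; proj₂)
open import Data.List using ([]; _∷_; _++_; _∷ʳ_; length; map; cartesianProduct)
open import Data.Nat.ListAction using (sum)
open import Data.Nat.ListAction.Properties using (sum-++)
open import Data.List.Properties
  using (length-++; length-map; map-injective; ∷-injectiveˡ; ∷-injectiveʳ; ∷ʳ-injectiveˡ)
open import Data.List.Membership.Propositional using (_∈_)
open import Data.List.Membership.Propositional.Properties
  using (∈-++⁻; ∈-++⁺ˡ; ∈-++⁺ʳ; ∈-map⁺; ∈-map⁻; ∈-cartesianProduct⁺; ∈-cartesianProduct⁻)
open import Data.List.Membership.Propositional.Properties.WithK using (unique∧set⇒bag)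
open import Data.List.Relation.Binary.BagAndSetEquality using (∼bag⇒↭)
open import Data.List.Relation.Binary.Permutation.Propositional.Properties using (↭-length)
open import Data.List.Relation.Unary.All as All using (All; []; _∷_)
import Data.List.Relation.Unary.All.Properties as All
open import Data.List.Relation.Unary.Unique.Propositional using (Unique)
open import Data.List.Relation.Unary.Linked as Linked using (Linked; []; [-]; _∷_)
import Data.List.Relation.Unary.Linked.Properties as Linked
open import Data.List.Relation.Unary.AllPairs using ([]; _∷_)
open import Data.List.Relation.Unary.Any using (here; there)
import Data.List.Relation.Unary.Unique.Propositional.Properties as Unique
import Data.Product as Product
open import Data.Sum as Sum using (_⊎_; inj₁; inj₂; [_,_])
open import Function.Bundles using (mk⇔; module Equivalence)
open Equivalence using (to; from)
open import Function using (_∘_)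
open import Relation.Binary.PropositionalEquality
  using (refl; sym; trans; cong; cong₂; subst; _≢_; _≗_; _→-setoid_; module ≡-Reasoning)
import Relation.Binary.Reasoning.Setoid as SetoidReasoning
import Algebra.Properties.CommutativeSemigroup as CommutativeSemigroupProperties
import Algebra.Properties.Group as GroupProperties
open import Algebra.Bundles using (AbelianGroup)
open import Relation.Nullary using (¬_; yes; no)

<ᵇ-true : ∀ {m n} → m < n → (m <ᵇ n) ≡ true
<ᵇ-true {zero}  {suc n} _         = refl
<ᵇ-true {suc m} {suc n} (s≤s m<n) = <ᵇ-true m<n

<ᵇ-false : ∀ {m n} → n ≤ m → (m <ᵇ n) ≡ false
<ᵇ-false {m}     {zero}  _         = refl
<ᵇ-false {suc m} {suc n} (s≤s n≤m) = <ᵇ-false n≤m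

≤ᵇ-true : ∀ {m n} → m ≤ n → (m ≤ᵇ n) ≡ true
≤ᵇ-true {zero}  _         = refl
≤ᵇ-true {suc m} (s≤s m≤n) = <ᵇ-true (s≤s m≤n)

≤ᵇ-false : ∀ {m n} → n < m → (m ≤ᵇ n) ≡ false
≤ᵇ-false {suc m} (s≤s n≤m) = <ᵇ-false n≤m

m+n≡o⇒m≤o : ∀ m {n o} → m + n ≡ o → m ≤ o
m+n≡o⇒m≤o m {n} refl = ℕₚ.m≤m+n m n

m+n≡o⇒n≡o∸m : ∀ m {n o} → m + n ≡ o → n ≡ o ∸ m
m+n≡o⇒n≡o∸m m {n} refl = sym (ℕₚ.m+n∸m≡n m n)

-- Finite sums

sumTo-cong≤ : ∀ n {f g : ℕ → ℤ} → (∀ i → i ≤ n → f i ≡ g i) → sumTo n f ≡ sumTo n g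
sumTo-cong≤ zero     eq = eq 0 z≤n
sumTo-cong≤ (suc n) eq =
  cong₂ _+ℤ_ (sumTo-cong≤ n (λ i i≤n → eq i (ℕₚ.m≤n⇒m≤1+n i≤n))) (eq (suc n) ℕₚ.≤-refl)

sumTo-cong : ∀ n {f g : ℕ → ℤ} → f ≗ g → sumTo n f ≡ sumTo n g
sumTo-cong n eq = sumTo-cong≤ n (λ i _ → eq i)

sumTo-zero : ∀ n (f : ℕ → ℤ) → (∀ i → i ≤ n → f i ≡ 0ℤ) → sumTo n f ≡ 0ℤ
sumTo-zero zero    f eq = eq 0 z≤n
sumTo-zero (suc n) f eq =
  cong₂ _+ℤ_ (sumTo-zero n f (λ i i≤n → eq i (ℕₚ.m≤n⇒m≤1+n i≤n))) (eq (suc n) ℕₚ.≤-refl)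

sumTo-+ : ∀ n (f g : ℕ → ℤ) → sumTo n (λ i → f i +ℤ g i) ≡ sumTo n f +ℤ sumTo n g
sumTo-+ zero    f g = refl
sumTo-+ (suc n) f g = trans (cong (_+ℤ (f (suc n) +ℤ g (suc n))) (sumTo-+ n f g))
                            (interchange (sumTo n f) (sumTo n g) (f (suc n)) (g (suc n)))
  where
  interchange : ∀ a b c d → (a +ℤ b) +ℤ (c +ℤ d) ≡ (a +ℤ c) +ℤ (b +ℤ d)
  interchange = solve-∀

sumTo-*ˡ : ∀ n c (f : ℕ → ℤ) → c *ℤ sumTo n f ≡ sumTo n (λ i → c *ℤ f i)
sumTo-*ˡ zero    c f = refl
sumTo-*ˡ (suc n) c f = trans (ℤₚ.*-distribˡ-+ c (sumTo n f) (f (suc n)))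
                             (cong (_+ℤ c *ℤ f (suc n)) (sumTo-*ˡ n c f))

sumTo-*ʳ : ∀ n c (f : ℕ → ℤ) → sumTo n f *ℤ c ≡ sumTo n (λ i → f i *ℤ c)
sumTo-*ʳ n c f = trans (ℤₚ.*-comm (sumTo n f) c)
  (trans (sumTo-*ˡ n c f) (sumTo-cong n (λ i → ℤₚ.*-comm c (f i))))

sumTo-neg : ∀ n (f : ℕ → ℤ) → -ℤ sumTo n f ≡ sumTo n (λ i → -ℤ f i)
sumTo-neg zero    f = refl
sumTo-neg (suc n) f = trans (ℤₚ.neg-distrib-+ (sumTo n f) (f (suc n)))
                            (cong (_+ℤ -ℤ f (suc n)) (sumTo-neg n f))

sumTo-suc : ∀ n (f : ℕ → ℤ) → sumTo (suc n) f ≡ f 0 +ℤ sumTo n (f ∘ suc)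
sumTo-suc zero    f = refl
sumTo-suc (suc n) f =
  trans (cong (_+ℤ f (suc (suc n))) (sumTo-suc n f)) (ℤₚ.+-assoc (f 0) _ _)

sumTo-single : ∀ n j (f : ℕ → ℤ) → j ≤ n → (∀ i → i ≤ n → i ≢ j → f i ≡ 0ℤ) → sumTo n f ≡ f j
sumTo-single zero    zero f _   others = refl
sumTo-single (suc n) j    f j≤n others with j ≟ suc n
... | yes refl = trans (cong (_+ℤ f (suc n)) (sumTo-zero n f below)) (ℤₚ.+-identityˡ _)
  where
  below : ∀ i → i ≤ n → f i ≡ 0ℤ
  below i i≤n = others i (ℕₚ.m≤n⇒m≤1+n i≤n) (ℕₚ.<⇒≢ (s≤s i≤n))
... | no j≢n = trans (cong₂ _+ℤ_ earlier (others (suc n) ℕₚ.≤-refl (j≢n ∘ sym)))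
                     (ℤₚ.+-identityʳ _)
  where
  earlier : sumTo n f ≡ f j
  earlier = sumTo-single n j f (ℕₚ.≤-pred (ℕₚ.≤∧≢⇒< j≤n j≢n))
                         (λ i i≤n → others i (ℕₚ.m≤n⇒m≤1+n i≤n))

sumTo-dropInitial : ∀ t n (f : ℕ → ℤ) → (∀ i → i < t → f i ≡ 0ℤ) →
                    sumTo (t + n) f ≡ sumTo n (λ i → f (t + i))
sumTo-dropInitial zero    n f _     = refl
sumTo-dropInitial (suc t) n f zeros = begin
  sumTo (suc t + n) f                           ≡⟨ sumTo-suc (t + n) f ⟩
  f 0 +ℤ sumTo (t + n) (f ∘ suc)                 ≡⟨ cong₂ _+ℤ_ (zeros 0 (s≤s z≤n)) rest ⟩
  0ℤ +ℤ sumTo n (λ i → f (suc t + i))            ≡⟨ ℤₚ.+-identityˡ _ ⟩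
  sumTo n (λ i → f (suc t + i))                  ∎
  where
  open ≡-Reasoning
  rest = sumTo-dropInitial t n (f ∘ suc) (λ i i<t → zeros (suc i) (s≤s i<t))

sumTo-dropFinal : ∀ d n (f : ℕ → ℤ) → d ≤ n → (∀ i → d < i → f i ≡ 0ℤ) → sumTo n f ≡ sumTo d f
sumTo-dropFinal d zero    f z≤n   zeros = refl
sumTo-dropFinal d (suc n) f d≤1+n zeros with d ≟ suc n
... | yes refl = refl
... | no d≢1+n = trans (cong₂ _+ℤ_ (sumTo-dropFinal d n f d≤n zeros) (zeros (suc n) (s≤s d≤n)))
                       (ℤₚ.+-identityʳ _)
  where d≤n = ℕₚ.≤-pred (ℕₚ.≤∧≢⇒< d≤1+n d≢1+n)

sumTo-reverse : ∀ n (f : ℕ → ℤ) → sumTo n f ≡ sumTo n (λ i → f (n ∸ i))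
sumTo-reverse zero    f = refl
sumTo-reverse (suc n) f = begin
  sumTo n f +ℤ f (suc n)                           ≡⟨ cong (_+ℤ f (suc n)) (sumTo-reverse n f) ⟩
  sumTo n (λ i → f (n ∸ i)) +ℤ f (suc n)           ≡⟨ ℤₚ.+-comm _ (f (suc n)) ⟩
  f (suc n) +ℤ sumTo n (λ i → f (n ∸ i))           ≡⟨ sumTo-suc n (λ i → f (suc n ∸ i)) ⟨
  sumTo (suc n) (λ i → f (suc n ∸ i))              ∎
  where open ≡-Reasoning

sumTo-comm : ∀ n k (F : ℕ → ℕ → ℤ) →
             sumTo n (λ i → sumTo k (λ a → F a i)) ≡ sumTo k (λ a → sumTo n (F a))
sumTo-comm zero    k F = refl
sumTo-comm (suc n) k F = trans (cong (_+ℤ sumTo k (λ a → F a (suc n))) (sumTo-comm n k F))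
                               (sym (sumTo-+ k (λ a → sumTo n (F a)) (λ a → F a (suc n))))

sumTo-triangle : ∀ n (F : ℕ → ℕ → ℤ) →
  sumTo n (λ m → sumTo m (λ i → F i m)) ≡ sumTo n (λ i → sumTo (n ∸ i) (λ j → F i (i + j)))
sumTo-triangle zero    F = refl
sumTo-triangle (suc n) F = begin
  sumTo n (λ m → sumTo m (λ i → F i m)) +ℤ sumTo (suc n) (λ i → F i (suc n))
    ≡⟨ cong (_+ℤ sumTo (suc n) (λ i → F i (suc n))) (sumTo-triangle n F) ⟩
  inner n +ℤ (sumTo n (λ i → F i (suc n)) +ℤ F (suc n) (suc n))
    ≡⟨ ℤₚ.+-assoc (inner n) _ _ ⟨
  (inner n +ℤ sumTo n (λ i → F i (suc n))) +ℤ F (suc n) (suc n)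
    ≡⟨ cong₂ _+ℤ_ (sumTo-+ n _ _) (cong (F (suc n)) (ℕₚ.+-identityʳ (suc n))) ⟨
  sumTo n (λ i → sumTo (n ∸ i) (λ j → F i (i + j)) +ℤ F i (suc n)) +ℤ F (suc n) (suc n + 0)
    ≡⟨ cong₂ _+ℤ_ (sumTo-cong≤ n extend)
                  (cong (λ l → sumTo l (λ j → F (suc n) (suc n + j))) (ℕₚ.n∸n≡0 n)) ⟨
  inner (suc n)
    ∎
  where
  open ≡-Reasoning
  inner : ℕ → ℤ
  inner N = sumTo N (λ i → sumTo (N ∸ i) (λ j → F i (i + j)))
  extend : ∀ i → i ≤ n →
           sumTo (suc n ∸ i) (λ j → F i (i + j)) ≡ sumTo (n ∸ i) (λ j → F i (i + j)) +ℤ F i (suc n)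
  extend i i≤n rewrite ℕₚ.+-∸-assoc 1 i≤n =
    cong (λ m → sumTo (n ∸ i) (λ j → F i (i + j)) +ℤ F i m)
         (trans (ℕₚ.+-suc i (n ∸ i)) (cong suc (ℕₚ.m+[n∸m]≡n i≤n)))

-- Formal power series

zeroS : Series
zeroS _ = 0ℤ

infixl 6 _⊕_
_⊕_ : Series → Series → Series
(f ⊕ g) n = f n +ℤ g n

⊖_ : Series → Series
(⊖ f) n = -ℤ f n

⊛-cong : ∀ {f f′ g g′} → f ≗ f′ → g ≗ g′ → f ⊛ g ≗ f′ ⊛ g′
⊛-cong f≗f′ g≗g′ n = sumTo-cong n (λ m → cong₂ _*ℤ_ (f≗f′ m) (g≗g′ (n ∸ m)))

⊛-congˡ : ∀ f {g g′} → g ≗ g′ → f ⊛ g ≗ f ⊛ g′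
⊛-congˡ f = ⊛-cong {f} (λ _ → refl)

⊛-congʳ : ∀ g {f f′} → f ≗ f′ → f ⊛ g ≗ f′ ⊛ g
⊛-congʳ g f≗f′ = ⊛-cong {g = g} f≗f′ (λ _ → refl)

⊛-comm : ∀ f g → f ⊛ g ≗ g ⊛ f
⊛-comm f g n = trans (sumTo-reverse n (λ m → f m *ℤ g (n ∸ m))) (sumTo-cong≤ n swap)
  where
  swap : ∀ m → m ≤ n → f (n ∸ m) *ℤ g (n ∸ (n ∸ m)) ≡ g m *ℤ f (n ∸ m)
  swap m m≤n = trans (cong (λ i → f (n ∸ m) *ℤ g i) (ℕₚ.m∸[m∸n]≡n m≤n))
                     (ℤₚ.*-comm (f (n ∸ m)) (g m))

⊛-assoc : ∀ f g h → (f ⊛ g) ⊛ h ≗ f ⊛ (g ⊛ h)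
⊛-assoc f g h n = begin
  sumTo n (λ m → sumTo m (λ i → f i *ℤ g (m ∸ i)) *ℤ h (n ∸ m))
    ≡⟨ sumTo-cong n (λ m → sumTo-*ʳ m (h (n ∸ m)) (λ i → f i *ℤ g (m ∸ i))) ⟩
  sumTo n (λ m → sumTo m (λ i → f i *ℤ g (m ∸ i) *ℤ h (n ∸ m)))
    ≡⟨ sumTo-triangle n (λ i m → f i *ℤ g (m ∸ i) *ℤ h (n ∸ m)) ⟩
  sumTo n (λ i → sumTo (n ∸ i) (λ j → f i *ℤ g (i + j ∸ i) *ℤ h (n ∸ (i + j))))
    ≡⟨ sumTo-cong n (λ i → sumTo-cong (n ∸ i) (reindex i)) ⟩
  sumTo n (λ i → sumTo (n ∸ i) (λ j → f i *ℤ (g j *ℤ h (n ∸ i ∸ j))))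
    ≡⟨ sumTo-cong n (λ i → sumTo-*ˡ (n ∸ i) (f i) (λ j → g j *ℤ h (n ∸ i ∸ j))) ⟨
  sumTo n (λ i → f i *ℤ sumTo (n ∸ i) (λ j → g j *ℤ h (n ∸ i ∸ j)))
    ∎
  where
  open ≡-Reasoning
  reindex : ∀ i j → f i *ℤ g (i + j ∸ i) *ℤ h (n ∸ (i + j)) ≡ f i *ℤ (g j *ℤ h (n ∸ i ∸ j))
  reindex i j = trans (cong₂ (λ a b → f i *ℤ g a *ℤ h b) (ℕₚ.m+n∸m≡n i j) (sym (ℕₚ.∸-+-assoc n i j)))
                      (ℤₚ.*-assoc (f i) (g j) (h (n ∸ i ∸ j)))

⊛-identityˡ : ∀ f → oneS ⊛ f ≗ f
⊛-identityˡ f n = trans (sumTo-single n 0 _ z≤n onlyZero) (ℤₚ.*-identityˡ (f n))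
  where
  onlyZero : ∀ i → i ≤ n → i ≢ 0 → oneS i *ℤ f (n ∸ i) ≡ 0ℤ
  onlyZero zero    _ i≢0 = ⊥-elim (i≢0 refl)
  onlyZero (suc i) _ _   = refl

⊛-identityʳ : ∀ f → f ⊛ oneS ≗ f
⊛-identityʳ f n = trans (⊛-comm f oneS n) (⊛-identityˡ f n)

⊛-distribˡ : ∀ h f g → h ⊛ (f ⊕ g) ≗ (h ⊛ f) ⊕ (h ⊛ g)
⊛-distribˡ h f g n =
  trans (sumTo-cong n (λ m → ℤₚ.*-distribˡ-+ (h m) (f (n ∸ m)) (g (n ∸ m)))) (sumTo-+ n _ _)

⊛-distribʳ : ∀ h f g → (f ⊕ g) ⊛ h ≗ (f ⊛ h) ⊕ (g ⊛ h)
⊛-distribʳ h f g n =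
  trans (sumTo-cong n (λ m → ℤₚ.*-distribʳ-+ (h (n ∸ m)) (f m) (g m))) (sumTo-+ n _ _)

⊛-negʳ : ∀ f g → f ⊛ (⊖ g) ≗ ⊖ (f ⊛ g)
⊛-negʳ f g n =
  trans (sumTo-cong n (λ m → sym (ℤₚ.neg-distribʳ-* (f m) (g (n ∸ m))))) (sym (sumTo-neg n _))

⊛-zeroˡ : ∀ g → zeroS ⊛ g ≗ zeroS
⊛-zeroˡ g n = sumTo-zero n _ (λ _ _ → refl)

⊛-commutativeMonoid : CommutativeMonoid _ _
⊛-commutativeMonoid = record
  { Carrier = Series
  ; _≈_ = _≗_
  ; _∙_ = _⊛_
  ; ε = oneS
  ; isCommutativeMonoid = record
    { isMonoid = record
      { isSemigroup = record
        { isMagma = record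
          { isEquivalence = Setoid.isEquivalence (ℕ →-setoid ℤ)
          ; ∙-cong = ⊛-cong
          }
        ; assoc = ⊛-assoc
        }
      ; identity = ⊛-identityˡ , ⊛-identityʳ
      }
    ; comm = ⊛-comm
    }
  }

module ≗-Reasoning = SetoidReasoning (ℕ →-setoid ℤ)
module ⊛-Properties =
  CommutativeSemigroupProperties (CommutativeMonoid.commutativeSemigroup ⊛-commutativeMonoid)

shift-< : ∀ t f {n} → n < t → shift t f n ≡ 0ℤ
shift-< t f n<t rewrite <ᵇ-true n<t = refl

shift-≥ : ∀ t f {n} → t ≤ n → shift t f n ≡ f (n ∸ t)
shift-≥ t f t≤n rewrite <ᵇ-false t≤n = refl

shift-+ : ∀ t f i → shift t f (t + i) ≡ f i
shift-+ zero    f i = refl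
shift-+ (suc t) f i = shift-+ t f i

shift-cong : ∀ t {f g} → f ≗ g → shift t f ≗ shift t g
shift-cong t f≗g n with n <ᵇ t
... | true  = refl
... | false = f≗g (n ∸ t)

shift-shift : ∀ a b f → shift a (shift b f) ≗ shift (a + b) f
shift-shift zero    b f n       = refl
shift-shift (suc a) b f zero    = refl
shift-shift (suc a) b f (suc n) = shift-shift a b f n

shift-⊕ : ∀ t f g → shift t (f ⊕ g) ≗ shift t f ⊕ shift t g
shift-⊕ t f g n with n <ᵇ t
... | true  = refl
... | false = refl

shift-⊖ : ∀ t f → shift t (⊖ f) ≗ ⊖ shift t f
shift-⊖ t f n with n <ᵇ t
... | true  = refl
... | false = refl

shift-zeroS : ∀ t → shift t zeroS ≗ zeroS
shift-zeroS t n with n <ᵇ t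
... | true  = refl
... | false = refl

shift-⊛ : ∀ t f g → shift t f ⊛ g ≗ shift t (f ⊛ g)
shift-⊛ t f g n with n <? t
... | yes n<t = trans (sumTo-zero n _ (λ i i≤n → cong (_*ℤ g (n ∸ i)) (shift-< t f (ℕₚ.≤-<-trans i≤n n<t))))
                      (sym (shift-< t (f ⊛ g) n<t))
... | no n≮t = begin
  sumTo n (λ m → shift t f m *ℤ g (n ∸ m))
    ≡⟨ cong (λ l → sumTo l (λ m → shift t f m *ℤ g (n ∸ m))) (ℕₚ.m+[n∸m]≡n t≤n) ⟨
  sumTo (t + (n ∸ t)) (λ m → shift t f m *ℤ g (n ∸ m))
    ≡⟨ sumTo-dropInitial t (n ∸ t) _ (λ i i<t → cong (_*ℤ g (n ∸ i)) (shift-< t f i<t)) ⟩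
  sumTo (n ∸ t) (λ i → shift t f (t + i) *ℤ g (n ∸ (t + i)))
    ≡⟨ sumTo-cong (n ∸ t) (λ i → cong₂ _*ℤ_ (shift-+ t f i) (cong g (sym (ℕₚ.∸-+-assoc n t i)))) ⟩
  (f ⊛ g) (n ∸ t)
    ≡⟨ shift-≥ t (f ⊛ g) t≤n ⟨
  shift t (f ⊛ g) n
    ∎
  where
  open ≡-Reasoning
  t≤n = ℕₚ.≮⇒≥ n≮t

⊛-shift : ∀ t f g → f ⊛ shift t g ≗ shift t (f ⊛ g)
⊛-shift t f g = begin
  f ⊛ shift t g     ≈⟨ ⊛-comm f (shift t g) ⟩
  shift t g ⊛ f     ≈⟨ shift-⊛ t g f ⟩
  shift t (g ⊛ f)   ≈⟨ shift-cong t (⊛-comm g f) ⟩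
  shift t (f ⊛ g)   ∎
  where open ≗-Reasoning

shift-⊛-shift : ∀ a b f g → shift a f ⊛ shift b g ≗ shift (a + b) (f ⊛ g)
shift-⊛-shift a b f g = begin
  shift a f ⊛ shift b g       ≈⟨ shift-⊛ a f (shift b g) ⟩
  shift a (f ⊛ shift b g)     ≈⟨ shift-cong a (⊛-shift b f g) ⟩
  shift a (shift b (f ⊛ g))   ≈⟨ shift-shift a b (f ⊛ g) ⟩
  shift (a + b) (f ⊛ g)       ∎
  where open ≗-Reasoning

oneMinusQ^≗ : ∀ i → oneMinusQ^ i ≗ oneS ⊕ ⊖ shift i oneS
oneMinusQ^≗ i n = cong (λ c → oneS n +ℤ -ℤ c) (monomial n i)
  where
  monomial : ∀ n i → (if n ≡ᵇ i then 1ℤ else 0ℤ) ≡ shift i oneS n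
  monomial zero    zero    = refl
  monomial zero    (suc i) = refl
  monomial (suc n) zero    = refl
  monomial (suc n) (suc i) = monomial n i

⊛-oneMinusQ^ : ∀ f i → f ⊛ oneMinusQ^ i ≗ f ⊕ ⊖ shift i f
⊛-oneMinusQ^ f i = begin
  f ⊛ oneMinusQ^ i                        ≈⟨ ⊛-congˡ f (oneMinusQ^≗ i) ⟩
  f ⊛ (oneS ⊕ ⊖ shift i oneS)             ≈⟨ ⊛-distribˡ f oneS (⊖ shift i oneS) ⟩
  f ⊛ oneS ⊕ f ⊛ (⊖ shift i oneS)
    ≈⟨ (λ n → cong₂ _+ℤ_ (⊛-identityʳ f n) (⊛-negʳ f (shift i oneS) n)) ⟩
  f ⊕ ⊖ (f ⊛ shift i oneS)                ≈⟨ (λ n → cong (λ c → f n +ℤ -ℤ c) (shifted n)) ⟩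
  f ⊕ ⊖ shift i f                         ∎
  where
  open ≗-Reasoning
  shifted : f ⊛ shift i oneS ≗ shift i f
  shifted n = trans (⊛-shift i f oneS n) (shift-cong i (⊛-identityʳ f) n)

den-zero : ∀ k → den k 0 ≡ 1ℤ
den-zero zero    = refl
den-zero (suc k) = cong (_*ℤ 1ℤ) (den-zero k)

sumSeries : ℕ → (ℕ → Series) → Series
sumSeries k F n = sumTo k (λ a → F a n)

sumSeries-cong≤ : ∀ k {F G : ℕ → Series} → (∀ a → a ≤ k → F a ≗ G a) → sumSeries k F ≗ sumSeries k G
sumSeries-cong≤ k F≗G n = sumTo-cong≤ k (λ a a≤k → F≗G a a≤k n)

sumSeries-⊛ : ∀ k (F : ℕ → Series) g → sumSeries k F ⊛ g ≗ sumSeries k (λ a → F a ⊛ g)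
sumSeries-⊛ k F g n = trans (sumTo-cong n (λ m → sumTo-*ʳ k (g (n ∸ m)) (λ a → F a m)))
                            (sumTo-comm n k (λ a m → F a m *ℤ g (n ∸ m)))

shift-sumSeries : ∀ t k (F : ℕ → Series) → shift t (sumSeries k F) ≗ sumSeries k (λ a → shift t (F a))
shift-sumSeries t k F n with n <ᵇ t
... | true  = sym (sumTo-zero k _ (λ _ _ → refl))
... | false = refl

⊛-cancelʳ : ∀ h {f f′} → h 0 ≡ 1ℤ → f ⊛ h ≗ f′ ⊛ h → f ≗ f′
⊛-cancelʳ h {f} {f′} h0≡1 eq n = agreeUpTo n n ℕₚ.≤-refl
  where
  times-h0 : ∀ g n → g n *ℤ h (n ∸ n) ≡ g n
  times-h0 g n = trans (cong (λ i → g n *ℤ h i) (ℕₚ.n∸n≡0 n))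
                       (trans (cong (g n *ℤ_) h0≡1) (ℤₚ.*-identityʳ (g n)))
  agreeUpTo : ∀ n m → m ≤ n → f m ≡ f′ m
  agreeUpTo zero    zero z≤n = trans (sym (times-h0 f 0)) (trans (eq 0) (times-h0 f′ 0))
  agreeUpTo (suc n) m m≤1+n with m ≟ suc n
  ... | no m≢1+n = agreeUpTo n m (ℕₚ.≤-pred (ℕₚ.≤∧≢⇒< m≤1+n m≢1+n))
  ... | yes refl = begin
    f (suc n)                          ≡⟨ times-h0 f (suc n) ⟨
    f (suc n) *ℤ h (suc n ∸ suc n)     ≡⟨ ∙-cancelˡ (sumTo n (λ i → f i *ℤ h (suc n ∸ i))) _ _ lastTerms ⟩
    f′ (suc n) *ℤ h (suc n ∸ suc n)    ≡⟨ times-h0 f′ (suc n) ⟩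
    f′ (suc n)                         ∎
    where
    open ≡-Reasoning
    open GroupProperties (AbelianGroup.group ℤₚ.+-0-abelianGroup) using (∙-cancelˡ)
    lastTerms = trans (eq (suc n)) (cong (_+ℤ f′ (suc n) *ℤ h (n ∸ n))
      (sumTo-cong≤ n (λ i i≤n → cong (_*ℤ h (suc n ∸ i)) (sym (agreeUpTo n i i≤n)))))

-- Degrees and leading terms

DegreeAtMost : Series → ℕ → Set
DegreeAtMost f d = ∀ i → d < i → f i ≡ 0ℤ

LeadingTerm : Series → ℕ → ℤ → Set
LeadingTerm f d c = DegreeAtMost f d × f d ≡ c

DegreeAtMost-mono : ∀ {f d d′} → d ≤ d′ → DegreeAtMost f d → DegreeAtMost f d′
DegreeAtMost-mono d≤d′ deg i d′<i = deg i (ℕₚ.≤-<-trans d≤d′ d′<i)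

DegreeAtMost-⊕ : ∀ {f g d} → DegreeAtMost f d → DegreeAtMost g d → DegreeAtMost (f ⊕ g) d
DegreeAtMost-⊕ degf degg i d<i = cong₂ _+ℤ_ (degf i d<i) (degg i d<i)

DegreeAtMost-oneS : DegreeAtMost oneS 0
DegreeAtMost-oneS (suc i) _ = refl

DegreeAtMost-shift : ∀ {f d} t → DegreeAtMost f d → DegreeAtMost (shift t f) (t + d)
DegreeAtMost-shift {f} {d} t deg i t+d<i = trans (shift-≥ t f t≤i) (deg (i ∸ t) d<i∸t)
  where
  t≤i = ℕₚ.≤-trans (ℕₚ.m≤m+n t d) (ℕₚ.<⇒≤ t+d<i)
  d<i∸t : d < i ∸ t
  d<i∸t = subst (_< i ∸ t) (ℕₚ.m+n∸m≡n t d) (ℕₚ.∸-monoˡ-< t+d<i (ℕₚ.m≤m+n t d))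

⊛-term-vanishes : ∀ {f g d₁ d₂ m i} → DegreeAtMost f d₁ → DegreeAtMost g d₂ → m ≤ i →
                  (m ≤ d₁ → m + d₂ < i) → f m *ℤ g (i ∸ m) ≡ 0ℤ
⊛-term-vanishes {f} {g} {d₁} {d₂} {m} {i} degf degg m≤i bound with d₁ <? m
... | yes d₁<m = cong (_*ℤ g (i ∸ m)) (degf m d₁<m)
... | no d₁≮m = trans (cong (f m *ℤ_) (degg (i ∸ m) d₂<i∸m)) (ℤₚ.*-zeroʳ (f m))
  where
  d₂<i∸m : d₂ < i ∸ m
  d₂<i∸m = ℕₚ.+-cancelˡ-< m d₂ (i ∸ m)
             (subst (m + d₂ <_) (sym (ℕₚ.m+[n∸m]≡n m≤i)) (bound (ℕₚ.≮⇒≥ d₁≮m)))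

DegreeAtMost-⊛ : ∀ {f g d₁ d₂} → DegreeAtMost f d₁ → DegreeAtMost g d₂ → DegreeAtMost (f ⊛ g) (d₁ + d₂)
DegreeAtMost-⊛ {d₂ = d₂} degf degg i d<i = sumTo-zero i _ (λ m m≤i →
  ⊛-term-vanishes degf degg m≤i (λ m≤d₁ → ℕₚ.≤-<-trans (ℕₚ.+-monoˡ-≤ d₂ m≤d₁) d<i))

⊛-top : ∀ {f g d₁ d₂} → DegreeAtMost f d₁ → DegreeAtMost g d₂ → (f ⊛ g) (d₁ + d₂) ≡ f d₁ *ℤ g d₂
⊛-top {f} {g} {d₁} {d₂} degf degg =
  trans (sumTo-single (d₁ + d₂) d₁ _ (ℕₚ.m≤m+n d₁ d₂) others)
        (cong (λ i → f d₁ *ℤ g i) (ℕₚ.m+n∸m≡n d₁ d₂))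
  where
  others : ∀ m → m ≤ d₁ + d₂ → m ≢ d₁ → f m *ℤ g (d₁ + d₂ ∸ m) ≡ 0ℤ
  others m m≤ m≢d₁ = ⊛-term-vanishes degf degg m≤
    (λ m≤d₁ → ℕₚ.+-monoˡ-< d₂ (ℕₚ.≤∧≢⇒< m≤d₁ m≢d₁))

LeadingTerm-oneS : LeadingTerm oneS 0 1ℤ
LeadingTerm-oneS = DegreeAtMost-oneS , refl

LeadingTerm-shift : ∀ {f d c} t → LeadingTerm f d c → LeadingTerm (shift t f) (t + d) c
LeadingTerm-shift {f} {d} t (deg , top) = DegreeAtMost-shift t deg , trans (shift-+ t f d) top

LeadingTerm-⊛ : ∀ {f g d₁ d₂ c₁ c₂} → LeadingTerm f d₁ c₁ → LeadingTerm g d₂ c₂ →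
                LeadingTerm (f ⊛ g) (d₁ + d₂) (c₁ *ℤ c₂)
LeadingTerm-⊛ (degf , topf) (degg , topg) =
  DegreeAtMost-⊛ degf degg , trans (⊛-top degf degg) (cong₂ _*ℤ_ topf topg)

LeadingTerm-⊕ˡ : ∀ {f g d c} → (∀ i → d ≤ i → g i ≡ 0ℤ) → LeadingTerm f d c → LeadingTerm (f ⊕ g) d c
LeadingTerm-⊕ˡ lower (degf , topf) =
  (λ i d<i → cong₂ _+ℤ_ (degf i d<i) (lower i (ℕₚ.<⇒≤ d<i))) ,
  trans (cong₂ _+ℤ_ topf (lower _ ℕₚ.≤-refl)) (ℤₚ.+-identityʳ _)

LeadingTerm-⊕ʳ : ∀ {f g d c} → (∀ i → d ≤ i → g i ≡ 0ℤ) → LeadingTerm f d c → LeadingTerm (g ⊕ f) d c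
LeadingTerm-⊕ʳ lower (degf , topf) =
  (λ i d<i → cong₂ _+ℤ_ (lower i (ℕₚ.<⇒≤ d<i)) (degf i d<i)) ,
  trans (cong₂ _+ℤ_ (lower _ ℕₚ.≤-refl) topf) (ℤₚ.+-identityˡ _)

LeadingTerm-oneMinusQ^ : ∀ m → LeadingTerm (oneMinusQ^ (suc m)) (suc m) -1ℤ
LeadingTerm-oneMinusQ^ m = degree , top m
  where
  degree : DegreeAtMost (oneMinusQ^ (suc m)) (suc m)
  degree i m<i = trans (oneMinusQ^≗ (suc m) i)
    (cong₂ _+ℤ_ (DegreeAtMost-oneS i (ℕₚ.≤-<-trans z≤n m<i))
                (cong -ℤ_ (DegreeAtMost-shift (suc m) DegreeAtMost-oneS i
                             (subst (_< i) (sym (ℕₚ.+-identityʳ (suc m))) m<i))))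
  top : ∀ m → oneMinusQ^ (suc m) (suc m) ≡ -1ℤ
  top zero    = refl
  top (suc m) = top m

triangular : ℕ → ℕ
triangular zero    = 0
triangular (suc r) = suc r + triangular r

triangular-+ : ∀ a b → triangular (a + b) ≡ triangular a + triangular b + a * b
triangular-+ zero    b = sym (ℕₚ.+-identityʳ (triangular b))
triangular-+ (suc a) b = trans (cong (_+_ (suc a + b)) (triangular-+ a b))
                               (rearrange a b (triangular a) (triangular b))
  where
  rearrange : ∀ a b x y → suc a + b + (x + y + a * b) ≡ suc a + x + y + suc a * b
  rearrange = ℕ-Solver.solve-∀

triangular-half : ∀ k → (k * suc k) / 2 ≡ triangular k
triangular-half k = trans (cong (_/ 2) (sym (twice k))) (ℕ-DivMod.m*n/n≡m (triangular k) 2)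
  where
  twice : ∀ k → triangular k * 2 ≡ k * suc k
  twice zero    = refl
  twice (suc k) = trans (ℕₚ.*-distribʳ-+ 2 (suc k) (triangular k))
                        (trans (cong (_+_ (suc k * 2)) (twice k)) (expand k))
    where
    expand : ∀ k → suc k * 2 + k * suc k ≡ suc k * suc (suc k)
    expand = ℕ-Solver.solve-∀

-- Numerator polynomials

-- Read off from Y-⊛-den in QRecursion below; the first summand is absent for r = m since
-- then Y m (r + 1) = 0.
numerator : ℕ → ℕ → Series
numerator m       zero    = oneS
numerator zero    (suc r) = zeroS
numerator (suc m) (suc r) =
  (if r <ᵇ m then numerator m (suc r) ⊛ oneMinusQ^ (suc m) else zeroS) ⊕ shift (m ∸ r) (numerator (suc m) r)

numerator-suc-< : ∀ m r → r < m →
  numerator (suc m) (suc r) ≗ numerator m (suc r) ⊛ oneMinusQ^ (suc m) ⊕ shift (m ∸ r) (numerator (suc m) r)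
numerator-suc-< m r r<m n rewrite <ᵇ-true r<m = refl

numerator-suc-≥ : ∀ m r → m ≤ r → numerator (suc m) (suc r) ≗ zeroS ⊕ shift (m ∸ r) (numerator (suc m) r)
numerator-suc-≥ m r m≤r n rewrite <ᵇ-false m≤r = refl

numerator-constant : ∀ m r → r ≤ m → numerator m r 0 ≡ 1ℤ
numerator-constant m       zero    _         = refl
numerator-constant (suc m) (suc r) (s≤s r≤m) with r <? m
... | yes r<m = begin
  numerator (suc m) (suc r) 0
    ≡⟨ numerator-suc-< m r r<m 0 ⟩
  numerator m (suc r) 0 *ℤ 1ℤ +ℤ shift (m ∸ r) (numerator (suc m) r) 0
    ≡⟨ cong₂ _+ℤ_ (cong (_*ℤ 1ℤ) (numerator-constant m (suc r) r<m))
                  (shift-< (m ∸ r) (numerator (suc m) r) (ℕₚ.m<n⇒0<n∸m r<m)) ⟩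
  1ℤ
    ∎
  where open ≡-Reasoning
... | no r≮m = begin
  numerator (suc m) (suc r) 0
    ≡⟨ numerator-suc-≥ m r m≤r 0 ⟩
  0ℤ +ℤ shift (m ∸ r) (numerator (suc m) r) 0
    ≡⟨ ℤₚ.+-identityˡ _ ⟩
  shift (m ∸ r) (numerator (suc m) r) 0
    ≡⟨ cong (λ t → shift t (numerator (suc m) r) 0) (ℕₚ.m≤n⇒m∸n≡0 m≤r) ⟩
  numerator (suc m) r 0
    ≡⟨ numerator-constant (suc m) r (ℕₚ.m≤n⇒m≤1+n r≤m) ⟩
  1ℤ
    ∎
  where
  open ≡-Reasoning
  m≤r = ℕₚ.≮⇒≥ r≮m

-- For 1 ≤ r ≤ m this is the degree of numerator m r; the top term comes from the factor
-- 1 - q^m when r = 1 and from the shifted summand when r > 1.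
numeratorDegree : ℕ → ℕ → ℕ
numeratorDegree zero          _             = 0
numeratorDegree (suc m)       zero          = 0
numeratorDegree (suc m)       (suc (suc r)) = (m ∸ suc r) + numeratorDegree (suc m) (suc r)
numeratorDegree (suc zero)    (suc zero)    = 0
numeratorDegree (suc (suc m)) (suc zero)    = numeratorDegree (suc m) 1 + suc (suc m)

numeratorDegree-suc : ∀ m s → 1 ≤ s → s ≤ m → numeratorDegree (suc m) s ≡ numeratorDegree m s + m + s
numeratorDegree-suc (suc m) (suc zero) _ _ = rearrange (numeratorDegree (suc m) 1) m
  where
  rearrange : ∀ d m → d + suc (suc m) ≡ d + suc m + 1
  rearrange = ℕ-Solver.solve-∀
numeratorDegree-suc (suc m) (suc (suc r)) _ (s≤s r<m) = begin
  (m ∸ r) + numeratorDegree (suc (suc m)) (suc r)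
    ≡⟨ cong₂ _+_ (ℕₚ.+-∸-assoc 1 r<m) (numeratorDegree-suc (suc m) (suc r) (s≤s z≤n) (ℕₚ.m≤n⇒m≤1+n r<m)) ⟩
  suc (m ∸ suc r) + (numeratorDegree (suc m) (suc r) + suc m + suc r)
    ≡⟨ rearrange (m ∸ suc r) (numeratorDegree (suc m) (suc r)) m r ⟩
  (m ∸ suc r) + numeratorDegree (suc m) (suc r) + suc m + suc (suc r)
    ∎
  where
  open ≡-Reasoning
  rearrange : ∀ x d m r → suc x + (d + suc m + suc r) ≡ x + d + suc m + suc (suc r)
  rearrange = ℕ-Solver.solve-∀

numeratorDegree-diagonal : ∀ m → numeratorDegree m m ≡ m * (m ∸ 1)
numeratorDegree-diagonal zero          = refl
numeratorDegree-diagonal (suc zero)    = refl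
numeratorDegree-diagonal (suc (suc m)) = begin
  (m ∸ m) + numeratorDegree (suc (suc m)) (suc m)
    ≡⟨ cong₂ _+_ (ℕₚ.n∸n≡0 m) (numeratorDegree-suc (suc m) (suc m) (s≤s z≤n) ℕₚ.≤-refl) ⟩
  numeratorDegree (suc m) (suc m) + suc m + suc m
    ≡⟨ cong (λ d → d + suc m + suc m) (numeratorDegree-diagonal (suc m)) ⟩
  suc m * m + suc m + suc m
    ≡⟨ expand m ⟩
  suc (suc m) * suc m
    ∎
  where
  open ≡-Reasoning
  expand : ∀ m → suc m * m + suc m + suc m ≡ suc (suc m) * suc m
  expand = ℕ-Solver.solve-∀

numerator-leading-column₁ : ∀ m →
  LeadingTerm (numerator (suc m) 1) (numeratorDegree (suc m) 1) (-1ℤ ^ m) →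
  LeadingTerm (numerator (suc (suc m)) 1) (numeratorDegree (suc (suc m)) 1) (-1ℤ ^ suc m)
numerator-leading-column₁ m ih =
  LeadingTerm-⊕ˡ lower (proj₁ product , trans (proj₂ product) (ℤₚ.*-comm (-1ℤ ^ m) -1ℤ))
  where
  product = LeadingTerm-⊛ ih (LeadingTerm-oneMinusQ^ (suc m))
  lower : ∀ i → numeratorDegree (suc (suc m)) 1 ≤ i → shift (suc m) oneS i ≡ 0ℤ
  lower i d≤i = DegreeAtMost-shift (suc m) DegreeAtMost-oneS i (ℕₚ.<-≤-trans below d≤i)
    where
    below : suc m + 0 < numeratorDegree (suc m) 1 + suc (suc m)
    below = subst (_< numeratorDegree (suc m) 1 + suc (suc m)) (sym (ℕₚ.+-identityʳ (suc m)))
                  (ℕₚ.m≤n+m (suc (suc m)) (numeratorDegree (suc m) 1))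

numerator-leading-column : ∀ m r c → suc r ≤ m →
  LeadingTerm (numerator (suc m) (suc r)) (numeratorDegree (suc m) (suc r)) c →
  (suc r < m → DegreeAtMost (numerator m (suc (suc r))) (numeratorDegree m (suc (suc r)))) →
  LeadingTerm (numerator (suc m) (suc (suc r))) (numeratorDegree (suc m) (suc (suc r))) c
numerator-leading-column m r c r<m ih previous = LeadingTerm-⊕ʳ lower (LeadingTerm-shift (m ∸ suc r) ih)
  where
  lower : ∀ i → numeratorDegree (suc m) (suc (suc r)) ≤ i →
          (if suc r <ᵇ m then numerator m (suc (suc r)) ⊛ oneMinusQ^ (suc m) else zeroS) i ≡ 0ℤ
  lower i d≤i with suc r <? m
  ... | no r+1≮m rewrite <ᵇ-false (ℕₚ.≮⇒≥ r+1≮m) = refl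
  ... | yes r+1<m rewrite <ᵇ-true r+1<m =
    DegreeAtMost-⊛ (previous r+1<m) (proj₁ (LeadingTerm-oneMinusQ^ m)) i (ℕₚ.<-≤-trans below d≤i)
    where
    d = numeratorDegree m (suc (suc r))
    below : d + suc m < numeratorDegree (suc m) (suc (suc r))
    below = subst (d + suc m <_) (sym (numeratorDegree-suc m (suc (suc r)) (s≤s z≤n) r+1<m))
                  (subst (d + suc m <_) (rearrange d m r) (ℕₚ.m<m+n (d + suc m) (s≤s z≤n)))
      where
      rearrange : ∀ d m r → d + suc m + suc r ≡ d + m + suc (suc r)
      rearrange = ℕ-Solver.solve-∀

numerator-leading : ∀ m r → 1 ≤ r → r ≤ m →
                    LeadingTerm (numerator m r) (numeratorDegree m r) (-1ℤ ^ (m ∸ 1))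
numerator-leading (suc m)       (suc (suc r)) _ (s≤s r<m) =
  numerator-leading-column m r _ r<m (numerator-leading (suc m) (suc r) (s≤s z≤n) (ℕₚ.m≤n⇒m≤1+n r<m))
    (λ r+1<m → proj₁ (numerator-leading m (suc (suc r)) (s≤s z≤n) r+1<m))
numerator-leading (suc zero)    (suc zero)    _ _ = (λ { (suc i) _ → refl }) , refl
numerator-leading (suc (suc m)) (suc zero)    _ _ =
  numerator-leading-column₁ m (numerator-leading (suc m) 1 (s≤s z≤n) (s≤s z≤n))

numerator-diagonal : ∀ m → LeadingTerm (numerator m m) (m * (m ∸ 1)) (-1ℤ ^ (m ∸ 1))
numerator-diagonal zero    = LeadingTerm-oneS
numerator-diagonal (suc m) = subst (λ d → LeadingTerm (numerator (suc m) (suc m)) d (-1ℤ ^ m))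
  (numeratorDegree-diagonal (suc m)) (numerator-leading (suc m) (suc m) (s≤s z≤n) ℕₚ.≤-refl)

oneMinusQ^-+ : ∀ a b → oneMinusQ^ a ⊕ shift a (oneMinusQ^ b) ≗ oneMinusQ^ (a + b)
oneMinusQ^-+ a b n = begin
  oneMinusQ^ a n +ℤ shift a (oneMinusQ^ b) n
    ≡⟨ cong₂ _+ℤ_ (oneMinusQ^≗ a n) (shift-cong a (oneMinusQ^≗ b) n) ⟩
  (oneS n +ℤ -ℤ shift a oneS n) +ℤ shift a (oneS ⊕ ⊖ shift b oneS) n
    ≡⟨ cong (λ x → (oneS n +ℤ -ℤ shift a oneS n) +ℤ x) (shift-⊕ a oneS (⊖ shift b oneS) n) ⟩
  (oneS n +ℤ -ℤ shift a oneS n) +ℤ (shift a oneS n +ℤ shift a (⊖ shift b oneS) n)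
    ≡⟨ cong (λ x → (oneS n +ℤ -ℤ shift a oneS n) +ℤ (shift a oneS n +ℤ x))
            (trans (shift-⊖ a (shift b oneS) n) (cong -ℤ_ (shift-shift a b oneS n))) ⟩
  (oneS n +ℤ -ℤ shift a oneS n) +ℤ (shift a oneS n +ℤ -ℤ shift (a + b) oneS n)
    ≡⟨ telescope (oneS n) (shift a oneS n) (shift (a + b) oneS n) ⟩
  oneS n +ℤ -ℤ shift (a + b) oneS n
    ≡⟨ oneMinusQ^≗ (a + b) n ⟨
  oneMinusQ^ (a + b) n
    ∎
  where
  open ≡-Reasoning
  telescope : ∀ x y z → (x +ℤ -ℤ y) +ℤ (y +ℤ -ℤ z) ≡ x +ℤ -ℤ z
  telescope = solve-∀

-- The q-binomial coefficient [a + b choose a].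
gaussian : ℕ → ℕ → Series
gaussian zero    b       = oneS
gaussian (suc a) zero    = oneS
gaussian (suc a) (suc b) = gaussian a (suc b) ⊕ shift (suc a) (gaussian (suc a) b)

gaussian-zeroʳ : ∀ a → gaussian a 0 ≡ oneS
gaussian-zeroʳ zero    = refl
gaussian-zeroʳ (suc a) = refl

gaussian-degree : ∀ a b → DegreeAtMost (gaussian a b) (a * b)
gaussian-degree zero    b       = DegreeAtMost-oneS
gaussian-degree (suc a) zero    = DegreeAtMost-mono z≤n DegreeAtMost-oneS
gaussian-degree (suc a) (suc b) = DegreeAtMost-⊕
  (DegreeAtMost-mono (ℕₚ.*-monoˡ-≤ (suc b) (ℕₚ.n≤1+n a)) (gaussian-degree a (suc b)))
  (subst (DegreeAtMost (shift (suc a) (gaussian (suc a) b))) (sym (ℕₚ.*-suc (suc a) b))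
         (DegreeAtMost-shift (suc a) (gaussian-degree (suc a) b)))

den-⊛-gaussian : ∀ a b → (den a ⊛ den b) ⊛ gaussian a b ≗ den (a + b)
den-⊛-gaussian zero    b       = begin
  (oneS ⊛ den b) ⊛ oneS   ≈⟨ ⊛-identityʳ (oneS ⊛ den b) ⟩
  oneS ⊛ den b            ≈⟨ ⊛-identityˡ (den b) ⟩
  den b                   ∎
  where open ≗-Reasoning
den-⊛-gaussian (suc a) zero    = begin
  (den (suc a) ⊛ oneS) ⊛ oneS   ≈⟨ ⊛-identityʳ (den (suc a) ⊛ oneS) ⟩
  den (suc a) ⊛ oneS            ≈⟨ ⊛-identityʳ (den (suc a)) ⟩
  den (suc a)                   ≡⟨ cong den (ℕₚ.+-identityʳ (suc a)) ⟨
  den (suc a + 0)               ∎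
  where open ≗-Reasoning
den-⊛-gaussian (suc a) (suc b) = begin
  (A ⊛ B) ⊛ (gaussian a (suc b) ⊕ shift (suc a) (gaussian (suc a) b))
    ≈⟨ ⊛-distribˡ (A ⊛ B) (gaussian a (suc b)) (shift (suc a) (gaussian (suc a) b)) ⟩
  (A ⊛ B) ⊛ gaussian a (suc b) ⊕ (A ⊛ B) ⊛ shift (suc a) (gaussian (suc a) b)
    ≈⟨ (λ n → cong₂ _+ℤ_ (left n) (right n)) ⟩
  den N ⊛ oneMinusQ^ (suc a) ⊕ den N ⊛ shift (suc a) (oneMinusQ^ (suc b))
    ≈⟨ ⊛-distribˡ (den N) (oneMinusQ^ (suc a)) (shift (suc a) (oneMinusQ^ (suc b))) ⟨
  den N ⊛ (oneMinusQ^ (suc a) ⊕ shift (suc a) (oneMinusQ^ (suc b)))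
    ≈⟨ ⊛-congˡ (den N) (oneMinusQ^-+ (suc a) (suc b)) ⟩
  den N ⊛ oneMinusQ^ (suc a + suc b)
    ≡⟨ cong (λ M → den M ⊛ oneMinusQ^ (suc a + suc b)) (ℕₚ.+-suc a b) ⟨
  den (suc a + suc b)
    ∎
  where
  open ≗-Reasoning
  open ⊛-Properties using (xy∙z≈xz∙y)
  A = den (suc a)
  B = den (suc b)
  N = suc (a + b)
  left : (A ⊛ B) ⊛ gaussian a (suc b) ≗ den N ⊛ oneMinusQ^ (suc a)
  left = begin
    ((den a ⊛ oneMinusQ^ (suc a)) ⊛ B) ⊛ gaussian a (suc b)
      ≈⟨ ⊛-congʳ (gaussian a (suc b)) (xy∙z≈xz∙y (den a) (oneMinusQ^ (suc a)) B) ⟩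
    ((den a ⊛ B) ⊛ oneMinusQ^ (suc a)) ⊛ gaussian a (suc b)
      ≈⟨ xy∙z≈xz∙y (den a ⊛ B) (oneMinusQ^ (suc a)) (gaussian a (suc b)) ⟩
    ((den a ⊛ B) ⊛ gaussian a (suc b)) ⊛ oneMinusQ^ (suc a)
      ≈⟨ ⊛-congʳ (oneMinusQ^ (suc a)) (den-⊛-gaussian a (suc b)) ⟩
    den (a + suc b) ⊛ oneMinusQ^ (suc a)
      ≡⟨ cong (λ M → den M ⊛ oneMinusQ^ (suc a)) (ℕₚ.+-suc a b) ⟩
    den N ⊛ oneMinusQ^ (suc a)
      ∎
  right : (A ⊛ B) ⊛ shift (suc a) (gaussian (suc a) b) ≗ den N ⊛ shift (suc a) (oneMinusQ^ (suc b))
  right = begin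
    (A ⊛ (den b ⊛ oneMinusQ^ (suc b))) ⊛ shift (suc a) (gaussian (suc a) b)
      ≈⟨ ⊛-shift (suc a) (A ⊛ (den b ⊛ oneMinusQ^ (suc b))) (gaussian (suc a) b) ⟩
    shift (suc a) ((A ⊛ (den b ⊛ oneMinusQ^ (suc b))) ⊛ gaussian (suc a) b)
      ≈⟨ shift-cong (suc a) (⊛-congʳ (gaussian (suc a) b) (⊛-assoc A (den b) (oneMinusQ^ (suc b)))) ⟨
    shift (suc a) (((A ⊛ den b) ⊛ oneMinusQ^ (suc b)) ⊛ gaussian (suc a) b)
      ≈⟨ shift-cong (suc a) (xy∙z≈xz∙y (A ⊛ den b) (oneMinusQ^ (suc b)) (gaussian (suc a) b)) ⟩
    shift (suc a) (((A ⊛ den b) ⊛ gaussian (suc a) b) ⊛ oneMinusQ^ (suc b))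
      ≈⟨ shift-cong (suc a) (⊛-congʳ (oneMinusQ^ (suc b)) (den-⊛-gaussian (suc a) b)) ⟩
    shift (suc a) (den N ⊛ oneMinusQ^ (suc b))
      ≈⟨ ⊛-shift (suc a) (den N) (oneMinusQ^ (suc b)) ⟨
    den N ⊛ shift (suc a) (oneMinusQ^ (suc b))
      ∎

gaussian-sym : ∀ a b → gaussian a b ≗ gaussian b a
gaussian-sym a b = ⊛-cancelʳ (den a ⊛ den b) constant (begin
  gaussian a b ⊛ (den a ⊛ den b)   ≈⟨ ⊛-comm (gaussian a b) (den a ⊛ den b) ⟩
  (den a ⊛ den b) ⊛ gaussian a b   ≈⟨ den-⊛-gaussian a b ⟩
  den (a + b)                      ≡⟨ cong den (ℕₚ.+-comm a b) ⟩
  den (b + a)                      ≈⟨ den-⊛-gaussian b a ⟨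
  (den b ⊛ den a) ⊛ gaussian b a   ≈⟨ ⊛-congʳ (gaussian b a) (⊛-comm (den b) (den a)) ⟩
  (den a ⊛ den b) ⊛ gaussian b a   ≈⟨ ⊛-comm (den a ⊛ den b) (gaussian b a) ⟩
  gaussian b a ⊛ (den a ⊛ den b)   ∎)
  where
  open ≗-Reasoning
  constant : (den a ⊛ den b) 0 ≡ 1ℤ
  constant = cong₂ _*ℤ_ (den-zero a) (den-zero b)

-- Solving a q-recursion

module QRecursion
  (Y : ℕ → ℕ → Series)
  (Y-base  : Y 0 0 ≗ oneS)
  (Y-empty : ∀ m r → m < r → Y m r ≗ zeroS)
  (Y-suc   : ∀ m r → r ≤ suc m → Y (suc m) r ≗ Y m r ⊕ shift (suc m) (Y (suc m) (r ∸ 1)))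
  where

  open ⊛-Properties using (x∙yz≈xz∙y)

  Y-⊛-den : ∀ m r → r ≤ m → Y m r ⊛ den m ≗ shift (triangular r) (numerator m r)
  Y-⊛-den zero    zero    _ n = trans (⊛-identityʳ (Y 0 0) n) (Y-base n)
  Y-⊛-den (suc m) zero    _ = begin
    Y (suc m) 0 ⊛ (den m ⊛ oneMinusQ^ (suc m))   ≈⟨ x∙yz≈xz∙y (Y (suc m) 0) (den m) (oneMinusQ^ (suc m)) ⟩
    (Y (suc m) 0 ⊛ oneMinusQ^ (suc m)) ⊛ den m   ≈⟨ ⊛-congʳ (den m) removeTop ⟩
    Y m 0 ⊛ den m                                 ≈⟨ Y-⊛-den m zero z≤n ⟩
    oneS                                          ∎
    where
    open ≗-Reasoning
    removeTop : Y (suc m) 0 ⊛ oneMinusQ^ (suc m) ≗ Y m 0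
    removeTop n = trans (⊛-oneMinusQ^ (Y (suc m) 0) (suc m) n)
      (trans (cong (_+ℤ -ℤ shift (suc m) (Y (suc m) 0) n) (Y-suc m 0 z≤n n)) (cancel _ _))
      where
      cancel : ∀ x y → x +ℤ y +ℤ -ℤ y ≡ x
      cancel = solve-∀
  Y-⊛-den (suc m) (suc r) (s≤s r≤m) = begin
    Y (suc m) (suc r) ⊛ den (suc m)
      ≈⟨ ⊛-congʳ (den (suc m)) (Y-suc m (suc r) (s≤s r≤m)) ⟩
    (Y m (suc r) ⊕ shift (suc m) (Y (suc m) r)) ⊛ den (suc m)
      ≈⟨ ⊛-distribʳ (den (suc m)) (Y m (suc r)) (shift (suc m) (Y (suc m) r)) ⟩
    Y m (suc r) ⊛ den (suc m) ⊕ shift (suc m) (Y (suc m) r) ⊛ den (suc m)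
      ≈⟨ (λ n → cong₂ _+ℤ_ (unshifted n) (shifted′ n)) ⟩
    shift (triangular (suc r)) carry ⊕ shift (triangular (suc r)) (shift (m ∸ r) (numerator (suc m) r))
      ≈⟨ shift-⊕ (triangular (suc r)) carry (shift (m ∸ r) (numerator (suc m) r)) ⟨
    shift (triangular (suc r)) (numerator (suc m) (suc r))
      ∎
    where
    open ≗-Reasoning
    carry = if r <ᵇ m then numerator m (suc r) ⊛ oneMinusQ^ (suc m) else zeroS
    unshifted : Y m (suc r) ⊛ den (suc m) ≗ shift (triangular (suc r)) carry
    unshifted with r <? m
    ... | yes r<m rewrite <ᵇ-true r<m = begin
      Y m (suc r) ⊛ (den m ⊛ oneMinusQ^ (suc m))
        ≈⟨ ⊛-assoc (Y m (suc r)) (den m) (oneMinusQ^ (suc m)) ⟨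
      (Y m (suc r) ⊛ den m) ⊛ oneMinusQ^ (suc m)
        ≈⟨ ⊛-congʳ (oneMinusQ^ (suc m)) (Y-⊛-den m (suc r) r<m) ⟩
      shift (triangular (suc r)) (numerator m (suc r)) ⊛ oneMinusQ^ (suc m)
        ≈⟨ shift-⊛ (triangular (suc r)) (numerator m (suc r)) (oneMinusQ^ (suc m)) ⟩
      shift (triangular (suc r)) (numerator m (suc r) ⊛ oneMinusQ^ (suc m))
        ∎
    ... | no r≮m rewrite <ᵇ-false (ℕₚ.≮⇒≥ r≮m) = begin
      Y m (suc r) ⊛ den (suc m)     ≈⟨ ⊛-congʳ (den (suc m)) (Y-empty m (suc r) (s≤s (ℕₚ.≮⇒≥ r≮m))) ⟩
      zeroS ⊛ den (suc m)           ≈⟨ ⊛-zeroˡ (den (suc m)) ⟩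
      zeroS                         ≈⟨ shift-zeroS (triangular (suc r)) ⟨
      shift (triangular (suc r)) zeroS ∎
    exponent : suc m + triangular r ≡ triangular (suc r) + (m ∸ r)
    exponent = trans (cong (λ x → suc x + triangular r) (sym (ℕₚ.m+[n∸m]≡n r≤m)))
                     (rearrange r (m ∸ r) (triangular r))
      where
      rearrange : ∀ a b c → suc (a + b + c) ≡ suc a + c + b
      rearrange = ℕ-Solver.solve-∀
    shifted′ : shift (suc m) (Y (suc m) r) ⊛ den (suc m) ≗
                         shift (triangular (suc r)) (shift (m ∸ r) (numerator (suc m) r))
    shifted′ = begin
      shift (suc m) (Y (suc m) r) ⊛ den (suc m)
        ≈⟨ shift-⊛ (suc m) (Y (suc m) r) (den (suc m)) ⟩
      shift (suc m) (Y (suc m) r ⊛ den (suc m))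
        ≈⟨ shift-cong (suc m) (Y-⊛-den (suc m) r (ℕₚ.m≤n⇒m≤1+n r≤m)) ⟩
      shift (suc m) (shift (triangular r) (numerator (suc m) r))
        ≈⟨ shift-shift (suc m) (triangular r) (numerator (suc m) r) ⟩
      shift (suc m + triangular r) (numerator (suc m) r)
        ≡⟨ cong (λ t → shift t (numerator (suc m) r)) exponent ⟩
      shift (triangular (suc r) + (m ∸ r)) (numerator (suc m) r)
        ≈⟨ shift-shift (triangular (suc r)) (m ∸ r) (numerator (suc m) r) ⟨
      shift (triangular (suc r)) (shift (m ∸ r) (numerator (suc m) r))
        ∎

-- Finite sets and their cardinalities

sumToℕ : ℕ → (ℕ → ℕ) → ℕ
sumToℕ zero    c = c 0
sumToℕ (suc K) c = sumToℕ K c + c (suc K)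

+-sumToℕ : ∀ K f → + sumToℕ K f ≡ sumTo K (λ j → + f j)
+-sumToℕ zero    f = refl
+-sumToℕ (suc K) f = trans (ℤₚ.pos-+ (sumToℕ K f) (f (suc K))) (cong (_+ℤ + f (suc K)) (+-sumToℕ K f))

private
  variable
    A B : Set

HasCard-resp : ∀ {P Q : A → Set} {c} → (∀ x → P x → Q x) → (∀ x → Q x → P x) → HasCard P c → HasCard Q c
HasCard-resp P⇒Q Q⇒P (xs , xs! , ∈xs , len) =
  xs , xs! , (λ x → mk⇔ (P⇒Q x ∘ to (∈xs x)) (from (∈xs x) ∘ Q⇒P x)) , len

HasCard-unique : ∀ {P : A → Set} {c d} → HasCard P c → HasCard P d → c ≡ d
HasCard-unique (xs , xs! , ∈xs , refl) (ys , ys! , ∈ys , refl) =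
  ↭-length (∼bag⇒↭ (unique∧set⇒bag xs! ys! (λ {x} → mk⇔ (from (∈ys x) ∘ to (∈xs x)) (from (∈xs x) ∘ to (∈ys x)))))

HasCard-empty : ∀ {P : A → Set} → (∀ x → ¬ P x) → HasCard P 0
HasCard-empty ¬P = [] , [] , (λ x → mk⇔ (λ ()) (⊥-elim ∘ ¬P x)) , refl

HasCard-singleton : ∀ {P : A → Set} y → (∀ x → P x → x ≡ y) → P y → HasCard P 1
HasCard-singleton y only Py =
  y ∷ [] , [] ∷ [] , (λ x → mk⇔ (λ { (here refl) → Py }) (here ∘ only x)) , refl

HasCard-⊎ : ∀ {P Q : A → Set} {a b} → HasCard P a → HasCard Q b → (∀ x → P x → ¬ Q x) →
            HasCard (λ x → P x ⊎ Q x) (a + b)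
HasCard-⊎ (xs , xs! , ∈xs , refl) (ys , ys! , ∈ys , refl) disjoint =
  xs ++ ys ,
  Unique.++⁺ xs! ys! (λ (x∈xs , x∈ys) → disjoint _ (to (∈xs _) x∈xs) (to (∈ys _) x∈ys)) ,
  (λ x → mk⇔ (Sum.map (to (∈xs x)) (to (∈ys x)) ∘ ∈-++⁻ xs)
             [ ∈-++⁺ˡ ∘ from (∈xs x) , ∈-++⁺ʳ xs ∘ from (∈ys x) ]) ,
  length-++ xs

HasCard-× : ∀ {P : A → Set} {Q : B → Set} {a b} → HasCard P a → HasCard Q b →
            HasCard (λ xy → P (proj₁ xy) × Q (proj₂ xy)) (a * b)
HasCard-× (xs , xs! , ∈xs , refl) (ys , ys! , ∈ys , refl) =
  cartesianProduct xs ys ,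
  Unique.cartesianProduct⁺ xs! ys! ,
  (λ (x , y) → mk⇔ (Product.map (to (∈xs x)) (to (∈ys y)) ∘ ∈-cartesianProduct⁻ xs ys)
                   (λ (Px , Qy) → ∈-cartesianProduct⁺ (from (∈xs x) Px) (from (∈ys y) Qy))) ,
  length-cartesianProduct xs ys
  where
  length-cartesianProduct : (xs : List A) (ys : List B) →
                            length (cartesianProduct xs ys) ≡ length xs * length ys
  length-cartesianProduct []       ys = refl
  length-cartesianProduct (x ∷ xs) ys = trans (length-++ (map (x ,_) ys))
    (cong₂ _+_ (length-map (x ,_) ys) (length-cartesianProduct xs ys))

Unique-map⁺ : ∀ (f : A → B) {xs} → (∀ {x y} → x ∈ xs → y ∈ xs → f x ≡ f y → x ≡ y) →
              Unique xs → Unique (map f xs)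
Unique-map⁺ f injective []           = []
Unique-map⁺ f injective (x∉xs ∷ xs!) =
  All.map⁺ (All.tabulate (λ y∈xs fx≡fy → All.lookup x∉xs y∈xs (injective (here refl) (there y∈xs) fx≡fy))) ∷
  Unique-map⁺ f (λ x∈ y∈ → injective (there x∈) (there y∈)) xs!

HasCard-image : ∀ {P : A → Set} {c} (f : A → B) →
                (∀ x y → P x → P y → f x ≡ f y → x ≡ y) → HasCard P c →
                HasCard (λ z → Σ A λ x → P x × f x ≡ z) c
HasCard-image f injective (xs , xs! , ∈xs , refl) =
  map f xs ,
  Unique-map⁺ f (λ {x} {y} x∈ y∈ → injective x y (to (∈xs x) x∈) (to (∈xs y) y∈)) xs! ,
  (λ z → mk⇔ (λ z∈ → let (x , x∈ , z≡fx) = ∈-map⁻ f z∈ in x , to (∈xs x) x∈ , sym z≡fx)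
             (λ { (x , Px , refl) → ∈-map⁺ f (from (∈xs x) Px) })) ,
  length-map f xs

HasCard-⋃ : ∀ K (Q : ℕ → A → Set) (c : ℕ → ℕ) → (∀ j → j ≤ K → HasCard (Q j) (c j)) →
            (∀ j j′ x → j ≤ K → j′ ≤ K → Q j x → Q j′ x → j ≡ j′) →
            HasCard (λ x → Σ ℕ λ j → j ≤ K × Q j x) (sumToℕ K c)
HasCard-⋃ zero    Q c card disjoint =
  HasCard-resp (λ x Qx → 0 , z≤n , Qx) (λ { x (0 , z≤n , Qx) → Qx }) (card 0 z≤n)
HasCard-⋃ (suc K) Q c card disjoint =
  HasCard-resp (λ x → [ (λ (j , j≤K , Qx) → j , ≤-step j≤K , Qx) , (λ Qx → suc K , ℕₚ.≤-refl , Qx) ])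
               (λ x (j , j≤1+K , Qx) → split j≤1+K Qx)
               (HasCard-⊎ (HasCard-⋃ K Q c (λ j j≤K → card j (≤-step j≤K))
                                     (λ j j′ x j≤K j′≤K → disjoint j j′ x (≤-step j≤K) (≤-step j′≤K)))
                          (card (suc K) ℕₚ.≤-refl)
                          (λ { x (j , j≤K , Qx) Qx′ →
                               ℕₚ.<⇒≢ (s≤s j≤K) (disjoint j (suc K) x (≤-step j≤K) ℕₚ.≤-refl Qx Qx′) }))
  where
  ≤-step = ℕₚ.m≤n⇒m≤1+n
  split : ∀ {x j} → j ≤ suc K → Q j x → (Σ ℕ λ j → j ≤ K × Q j x) ⊎ Q (suc K) x
  split {x} {j} j≤1+K Qx with j ≟ suc K
  ... | yes refl   = inj₂ Qx
  ... | no j≢1+K = inj₁ (j , ℕₚ.≤-pred (ℕₚ.≤∧≢⇒< j≤1+K j≢1+K) , Qx)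

HasCard-convolution : ∀ {P₁ : A → Set} {P₂ : B → Set} (w₁ : A → ℕ) (w₂ : B → ℕ) (c₁ c₂ : ℕ → ℕ) →
  (∀ j → HasCard (λ x → P₁ x × w₁ x ≡ j) (c₁ j)) →
  (∀ j → HasCard (λ y → P₂ y × w₂ y ≡ j) (c₂ j)) →
  ∀ N → HasCard (λ (x , y) → P₁ x × P₂ y × w₁ x + w₂ y ≡ N) (sumToℕ N (λ j → c₁ j * c₂ (N ∸ j)))
HasCard-convolution {P₁ = P₁} {P₂} w₁ w₂ c₁ c₂ card₁ card₂ N = HasCard-resp
  (λ { (x , y) (j , j≤N , (P₁x , refl) , (P₂y , w₂y≡)) →
       P₁x , P₂y , trans (cong (_+_ (w₁ x)) w₂y≡) (ℕₚ.m+[n∸m]≡n j≤N) })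
  (λ { (x , y) (P₁x , P₂y , refl) →
       w₁ x , ℕₚ.m≤m+n (w₁ x) (w₂ y) , (P₁x , refl) , (P₂y , sym (ℕₚ.m+n∸m≡n (w₁ x) (w₂ y))) })
  (HasCard-⋃ N (λ j (x , y) → (P₁ x × w₁ x ≡ j) × (P₂ y × w₂ y ≡ N ∸ j)) (λ j → c₁ j * c₂ (N ∸ j))
             (λ j _ → HasCard-× (card₁ j) (card₂ (N ∸ j)))
             (λ { j j′ (x , y) _ _ ((_ , refl) , _) ((_ , refl) , _) → refl }))

-- Descending lists and triangles

Descending : List ℕ → Set
Descending = Linked (λ a b → b ≤ a)

Fits : List ℕ → ℕ → Set
Fits xs       zero    = ⊤
Fits []       (suc r) = ⊥
Fits (x ∷ xs) (suc r) = r < x × Fits xs r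

Fits⇒TriangleFits : ∀ xs r → Fits xs r → TriangleFits xs r
Fits⇒TriangleFits (x ∷ xs) (suc r) (r<x , _)  (suc zero)    _ _         = r<x
Fits⇒TriangleFits (x ∷ xs) (suc r) (_ , fits) (suc (suc j)) _ (s≤s j<r) =
  Fits⇒TriangleFits xs r fits (suc j) (s≤s z≤n) j<r

TriangleFits⇒Fits : ∀ xs r → TriangleFits xs r → Fits xs r
TriangleFits⇒Fits xs       zero    _    = tt
TriangleFits⇒Fits []       (suc r) fits = ⊥-elim (ℕₚ.n≮0 (fits 1 (s≤s z≤n) (s≤s z≤n)))
TriangleFits⇒Fits (x ∷ xs) (suc r) fits =
  fits 1 (s≤s z≤n) (s≤s z≤n) ,
  TriangleFits⇒Fits xs r (λ { (suc j) _ j≤r → fits (suc (suc j)) (s≤s z≤n) (s≤s j≤r) })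

Fits-mono : ∀ xs {r s} → r ≤ s → Fits xs s → Fits xs r
Fits-mono xs       {zero}          _         _            = tt
Fits-mono (x ∷ xs) {suc r} {suc s} (s≤s r≤s) (s<x , fits) = ℕₚ.≤-<-trans r≤s s<x , Fits-mono xs r≤s fits

Fits-length : ∀ xs r → Fits xs r → r ≤ length xs
Fits-length xs       zero    _          = z≤n
Fits-length (x ∷ xs) (suc r) (_ , fits) = s≤s (Fits-length xs r fits)

DurfeeTriangleSize⇒Fits : ∀ xs k → DurfeeTriangleSize xs k → Fits xs k × ¬ Fits xs (suc k)
DurfeeTriangleSize⇒Fits xs k (fits , maximal) =
  TriangleFits⇒Fits xs k fits , λ fits′ → ℕₚ.1+n≰n (maximal (suc k) (Fits⇒TriangleFits xs (suc k) fits′))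

Fits⇒DurfeeTriangleSize : ∀ xs k → Fits xs k → ¬ Fits xs (suc k) → DurfeeTriangleSize xs k
Fits⇒DurfeeTriangleSize xs k fits ¬fits = Fits⇒TriangleFits xs k fits , maximal
  where
  maximal : ∀ m → TriangleFits xs m → m ≤ k
  maximal m fitsₘ with m ≤? k
  ... | yes m≤k = m≤k
  ... | no m≰k  = ⊥-elim (¬fits (Fits-mono xs (ℕₚ.≰⇒> m≰k) (TriangleFits⇒Fits xs m fitsₘ)))

Descending-∷ʳ0 : ∀ {xs} → Descending xs → Descending (xs ∷ʳ 0)
Descending-∷ʳ0 []                 = [-]
Descending-∷ʳ0 [-]                = z≤n ∷ [-]
Descending-∷ʳ0 (y≤x ∷ descending) = y≤x ∷ Descending-∷ʳ0 descending

Descending-∷ʳ0⁻ : ∀ xs → Descending (xs ∷ʳ 0) → Descending xs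
Descending-∷ʳ0⁻ []           _                  = []
Descending-∷ʳ0⁻ (x ∷ [])     _                  = [-]
Descending-∷ʳ0⁻ (x ∷ y ∷ xs) (y≤x ∷ descending) = y≤x ∷ Descending-∷ʳ0⁻ (y ∷ xs) descending

Descending-map-+ : ∀ c {xs} → Descending xs → Descending (map (_+_ c) xs)
Descending-map-+ c = Linked.map⁺ ∘ Linked.map (ℕₚ.+-monoʳ-≤ c)

Descending-map-+⁻ : ∀ c {xs} → Descending (map (_+_ c) xs) → Descending xs
Descending-map-+⁻ c = Linked.map (ℕₚ.+-cancelˡ-≤ c _ _) ∘ Linked.map⁻

Descending-++ : ∀ {xs ys} → Descending xs → Descending ys → All (λ x → All (_≤ x) ys) xs →
                Descending (xs ++ ys)
Descending-++ []                 dys _                = dys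
Descending-++ [-]                []  _                = [-]
Descending-++ [-]                [-] ((y≤x ∷ []) ∷ []) = y≤x ∷ [-]
Descending-++ [-]                (z≤y ∷ dys) ((y≤x ∷ _) ∷ []) = y≤x ∷ z≤y ∷ dys
Descending-++ (y≤x ∷ dxs)        dys (_ ∷ above)      = y≤x ∷ Descending-++ dxs dys above

Descending-head : ∀ {x xs} → Descending (x ∷ xs) → All (_≤ x) xs
Descending-head descending =
  All.tail (Linked.Linked⇒All {R = λ a b → b ≤ a} (λ j≤i k≤j → ℕₚ.≤-trans k≤j j≤i) ℕₚ.≤-refl descending)

Descending-∷ : ∀ {x xs} → All (_≤ x) xs → Descending xs → Descending (x ∷ xs)
Descending-∷ []        _          = [-]
Descending-∷ (y≤x ∷ _) descending = y≤x ∷ descending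

Fits-∷ : ∀ x xs r → r ≤ x → Fits xs (r ∸ 1) → Fits (x ∷ xs) r
Fits-∷ x xs zero    _   _    = tt
Fits-∷ x xs (suc r) r<x fits = r<x , fits

Descending-positive⊎lastZero : ∀ xs → Descending xs →
  (Σ (List ℕ) λ μ → xs ≡ map suc μ) ⊎ (Σ (List ℕ) λ μ → xs ≡ μ ∷ʳ 0)
Descending-positive⊎lastZero []            _ = inj₁ ([] , refl)
Descending-positive⊎lastZero (zero  ∷ [])  _ = inj₂ ([] , refl)
Descending-positive⊎lastZero (suc x ∷ [])  _ = inj₁ (x ∷ [] , refl)
Descending-positive⊎lastZero (x ∷ y ∷ xs) (y≤x ∷ descending)
  with Descending-positive⊎lastZero (y ∷ xs) descending
... | inj₂ (μ , eq)         = inj₂ (x ∷ μ , cong (x ∷_) eq)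
... | inj₁ (y′ ∷ μ , refl) with y≤x
...   | s≤s _ = inj₁ (_ ∷ y′ ∷ μ , refl)

Fits-∷ʳ0 : ∀ xs r → Fits xs r → Fits (xs ∷ʳ 0) r
Fits-∷ʳ0 xs       zero    _            = tt
Fits-∷ʳ0 (x ∷ xs) (suc r) (r<x , fits) = r<x , Fits-∷ʳ0 xs r fits

Fits-∷ʳ0⁻ : ∀ xs r → Fits (xs ∷ʳ 0) r → Fits xs r
Fits-∷ʳ0⁻ xs       zero    _            = tt
Fits-∷ʳ0⁻ (x ∷ xs) (suc r) (r<x , fits) = r<x , Fits-∷ʳ0⁻ xs r fits

Fits-map-suc : ∀ xs r → r ≤ length xs → Fits xs (r ∸ 1) → Fits (map suc xs) r
Fits-map-suc xs       zero          _         _            = tt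
Fits-map-suc (x ∷ xs) (suc zero)    _         _            = s≤s z≤n , tt
Fits-map-suc (x ∷ xs) (suc (suc r)) (s≤s r<l) (r<x , fits) = s≤s r<x , Fits-map-suc xs (suc r) r<l fits

Fits-map-suc⁻ : ∀ xs r → Fits (map suc xs) r → Fits xs (r ∸ 1)
Fits-map-suc⁻ xs       zero          _                  = tt
Fits-map-suc⁻ (x ∷ xs) (suc zero)    _                  = tt
Fits-map-suc⁻ (x ∷ xs) (suc (suc r)) (s≤s r<x , fits) = r<x , Fits-map-suc⁻ xs (suc r) fits

sum-∷ʳ0 : ∀ xs → sum (xs ∷ʳ 0) ≡ sum xs
sum-∷ʳ0 xs = trans (sum-++ xs (0 ∷ [])) (ℕₚ.+-identityʳ (sum xs))

sum-map-+ : ∀ c xs → sum (map (_+_ c) xs) ≡ length xs * c + sum xs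
sum-map-+ c []       = refl
sum-map-+ c (x ∷ xs) = trans (cong (_+_ (c + x)) (sum-map-+ c xs)) (rearrange c x (length xs) (sum xs))
  where
  rearrange : ∀ c x l s → c + x + (l * c + s) ≡ suc l * c + (x + s)
  rearrange = ℕ-Solver.solve-∀

sum-map-suc : ∀ xs → sum (map suc xs) ≡ length xs + sum xs
sum-map-suc xs = trans (sum-map-+ 1 xs) (cong (_+ sum xs) (ℕₚ.*-identityʳ (length xs)))

length-∷ʳ : ∀ (xs : List ℕ) x → length (xs ∷ʳ x) ≡ suc (length xs)
length-∷ʳ xs x = trans (length-++ xs) (ℕₚ.+-comm (length xs) 1)

-- Families of partitions counted by a q-recursion

Shifted-by : (ℕ → ℕ → ℕ → List ℕ → Set) → ℕ → ℕ → ℕ → List ℕ → Set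
Shifted-by P m r n xs = suc m ≤ n × P (suc m) (r ∸ 1) (n ∸ suc m) xs

module CountingFamily
  (P : ℕ → ℕ → ℕ → List ℕ → Set)
  (P-base  : ∀ n xs → P 0 0 n xs → xs ≡ [] × n ≡ 0)
  (P-[]    : P 0 0 0 [])
  (P-empty : ∀ m r n xs → m < r → ¬ P m r n xs)
  (P-step  : ∀ m r n {c₁ c₂} → r ≤ suc m → HasCard (P m r n) c₁ →
             HasCard (Shifted-by P m r n) c₂ →
             HasCard (P (suc m) r n) (c₁ + c₂))
  where

  base-HasCard : HasCard (P 0 0 0) 1
  base-HasCard = HasCard-singleton [] (λ xs → proj₁ ∘ P-base 0 xs) P-[]

  base-suc-HasCard : ∀ n → HasCard (P 0 0 (suc n)) 0
  base-suc-HasCard n = HasCard-empty (λ xs p → ℕₚ.1+n≢0 (proj₂ (P-base (suc n) xs p)))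

  empty-HasCard : ∀ m r n → m < r → HasCard (P m r n) 0
  empty-HasCard m r n m<r = HasCard-empty (λ xs → P-empty m r n xs m<r)

  Shifted-HasCard : ∀ m r n {c} → suc m ≤ n → HasCard (P (suc m) (r ∸ 1) (n ∸ suc m)) c →
                    HasCard (Shifted-by P m r n) c
  Shifted-HasCard m r n le = HasCard-resp (λ _ p → le , p) (λ _ → proj₂)

  Shifted-HasCard-< : ∀ m r n → n < suc m → HasCard (Shifted-by P m r n) 0
  Shifted-HasCard-< m r n n<1+m = HasCard-empty (λ _ (le , _) → ℕₚ.<⇒≱ n<1+m le)

  count-exists : ∀ m r n → Σ ℕ (HasCard (P m r n))
  count-exists m r n = <-rec (λ n → ∀ m r → Σ ℕ (HasCard (P m r n))) counts n m r
    where
    counts : ∀ n → (∀ {n′} → n′ < n → ∀ m r → Σ ℕ (HasCard (P m r n′))) →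
             ∀ m r → Σ ℕ (HasCard (P m r n))
    counts zero    _ zero zero    = 1 , base-HasCard
    counts (suc n) _ zero zero    = 0 , base-suc-HasCard n
    counts n       _ zero (suc r) = 0 , empty-HasCard 0 (suc r) n (s≤s z≤n)
    counts n smaller (suc m) r with suc m <? r
    ... | yes m<r = 0 , empty-HasCard (suc m) r n m<r
    ... | no m≮r  = c₁ + c₂ , P-step m r n (ℕₚ.≮⇒≥ m≮r) card₁ card₂
      where
      c₁ = proj₁ (counts n smaller m r)
      card₁ = proj₂ (counts n smaller m r)
      shifted : Σ ℕ (HasCard (Shifted-by P m r n))
      shifted with n <? suc m
      ... | yes n<1+m = 0 , Shifted-HasCard-< m r n n<1+m
      ... | no n≮1+m  =
        let 1+m≤n = ℕₚ.≮⇒≥ n≮1+m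
            (c , card) = smaller (ℕₚ.∸-monoʳ-< {n} {suc m} {0} (s≤s z≤n) 1+m≤n) (suc m) (r ∸ 1)
        in c , Shifted-HasCard m r n 1+m≤n card
      c₂ = proj₁ shifted
      card₂ = proj₂ shifted

  count : ℕ → ℕ → ℕ → ℕ
  count m r n = proj₁ (count-exists m r n)

  count-HasCard : ∀ m r n → HasCard (P m r n) (count m r n)
  count-HasCard m r n = proj₂ (count-exists m r n)

  generatingFunction : ℕ → ℕ → Series
  generatingFunction m r n = + count m r n

  generatingFunction-base : generatingFunction 0 0 ≗ oneS
  generatingFunction-base zero    = cong +_ (HasCard-unique (count-HasCard 0 0 0) base-HasCard)
  generatingFunction-base (suc n) = cong +_ (HasCard-unique (count-HasCard 0 0 (suc n)) (base-suc-HasCard n))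

  generatingFunction-empty : ∀ m r → m < r → generatingFunction m r ≗ zeroS
  generatingFunction-empty m r m<r n = cong +_ (HasCard-unique (count-HasCard m r n) (empty-HasCard m r n m<r))

  generatingFunction-suc : ∀ m r → r ≤ suc m →
    generatingFunction (suc m) r ≗ generatingFunction m r ⊕ shift (suc m) (generatingFunction (suc m) (r ∸ 1))
  generatingFunction-suc m r r≤1+m n with n <? suc m
  ... | yes n<1+m = begin
    + count (suc m) r n
      ≡⟨ cong +_ (HasCard-unique (count-HasCard (suc m) r n)
                   (P-step m r n r≤1+m (count-HasCard m r n) (Shifted-HasCard-< m r n n<1+m))) ⟩
    + (count m r n + 0)
      ≡⟨ cong +_ (ℕₚ.+-identityʳ _) ⟩
    + count m r n
      ≡⟨ ℤₚ.+-identityʳ _ ⟨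
    + count m r n +ℤ 0ℤ
      ≡⟨ cong (_+ℤ_ (+ count m r n)) (shift-< (suc m) (generatingFunction (suc m) (r ∸ 1)) n<1+m) ⟨
    generatingFunction m r n +ℤ shift (suc m) (generatingFunction (suc m) (r ∸ 1)) n
      ∎
    where open ≡-Reasoning
  ... | no n≮1+m = begin
    + count (suc m) r n
      ≡⟨ cong +_ (HasCard-unique (count-HasCard (suc m) r n)
                   (P-step m r n r≤1+m (count-HasCard m r n)
                           (Shifted-HasCard m r n le (count-HasCard (suc m) (r ∸ 1) (n ∸ suc m))))) ⟩
    + (count m r n + count (suc m) (r ∸ 1) (n ∸ suc m))
      ≡⟨ ℤₚ.pos-+ (count m r n) _ ⟩
    + count m r n +ℤ generatingFunction (suc m) (r ∸ 1) (n ∸ suc m)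
      ≡⟨ cong (_+ℤ_ (+ count m r n)) (shift-≥ (suc m) (generatingFunction (suc m) (r ∸ 1)) le) ⟨
    generatingFunction m r n +ℤ shift (suc m) (generatingFunction (suc m) (r ∸ 1)) n
      ∎
    where
    open ≡-Reasoning
    le = ℕₚ.≮⇒≥ n≮1+m

  open QRecursion generatingFunction generatingFunction-base generatingFunction-empty generatingFunction-suc public
    using (Y-⊛-den)

-- The two families cut off a partition by its Durfee triangle

RowShape : ℕ → ℕ → List ℕ → Set
RowShape m r γ = length γ ≡ m × Descending γ × Fits γ r

Rows : ℕ → ℕ → ℕ → List ℕ → Set
Rows m r n γ = RowShape m r γ × sum γ ≡ n

Rows-base : ∀ n γ → Rows 0 0 n γ → γ ≡ [] × n ≡ 0
Rows-base n [] ((refl , _) , refl) = refl , refl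

Rows-[] : Rows 0 0 0 []
Rows-[] = (refl , [] , tt) , refl

Rows-empty : ∀ m r n γ → m < r → ¬ Rows m r n γ
Rows-empty m r n γ m<r ((refl , _ , fits) , _) = ℕₚ.<⇒≱ m<r (Fits-length γ r fits)

Rows-∷ʳ0 : ∀ m r n μ → Rows m r n μ → Rows (suc m) r n (μ ∷ʳ 0)
Rows-∷ʳ0 m r n μ ((refl , descending , fits) , refl) =
  (length-∷ʳ μ 0 , Descending-∷ʳ0 descending , Fits-∷ʳ0 μ r fits) , sum-∷ʳ0 μ

Rows-∷ʳ0⁻ : ∀ m r n μ → Rows (suc m) r n (μ ∷ʳ 0) → Rows m r n μ
Rows-∷ʳ0⁻ m r n μ ((length≡ , descending , fits) , refl) =
  (ℕₚ.suc-injective (trans (sym (length-∷ʳ μ 0)) length≡) ,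
   Descending-∷ʳ0⁻ μ descending , Fits-∷ʳ0⁻ μ r fits) ,
  sym (sum-∷ʳ0 μ)

Rows-map-suc : ∀ m r n μ → r ≤ suc m → Shifted-by Rows m r n μ → Rows (suc m) r n (map suc μ)
Rows-map-suc m r n μ r≤1+m (1+m≤n , (length≡ , descending , fits) , sum≡) =
  (trans (length-map suc μ) length≡ , Descending-map-+ 1 descending ,
   Fits-map-suc μ r (subst (r ≤_) (sym length≡) r≤1+m) fits) ,
  trans (sum-map-suc μ) (trans (cong₂ _+_ length≡ sum≡) (ℕₚ.m+[n∸m]≡n 1+m≤n))

Rows-map-suc⁻ : ∀ m r n μ → Rows (suc m) r n (map suc μ) → Shifted-by Rows m r n μ
Rows-map-suc⁻ m r n μ ((length≡ , descending , fits) , sum≡) =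
  m+n≡o⇒m≤o (suc m) total , (length≡′ , Descending-map-+⁻ 1 descending , Fits-map-suc⁻ μ r fits) ,
  m+n≡o⇒n≡o∸m (suc m) total
  where
  length≡′ = trans (sym (length-map suc μ)) length≡
  total : suc m + sum μ ≡ n
  total = trans (cong (_+ sum μ) (sym length≡′)) (trans (sym (sum-map-suc μ)) sum≡)

-- Either the last part is 0 and is dropped, or all parts are positive and each loses 1.
Rows-step : ∀ m r n {c₁ c₂} → r ≤ suc m → HasCard (Rows m r n) c₁ → HasCard (Shifted-by Rows m r n) c₂ →
            HasCard (Rows (suc m) r n) (c₁ + c₂)
Rows-step m r n r≤1+m card₁ card₂ = HasCard-resp forward backward
  (HasCard-⊎ (HasCard-image (_∷ʳ 0) (λ μ μ′ _ _ → ∷ʳ-injectiveˡ μ μ′) card₁)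
             (HasCard-image (map suc) (λ _ _ _ _ → map-injective ℕₚ.suc-injective) card₂)
             disjoint)
  where
  Dropped Lowered : List ℕ → Set
  Dropped γ = Σ (List ℕ) λ μ → Rows m r n μ × μ ∷ʳ 0 ≡ γ
  Lowered γ = Σ (List ℕ) λ μ → Shifted-by Rows m r n μ × map suc μ ≡ γ
  forward : ∀ γ → Dropped γ ⊎ Lowered γ → Rows (suc m) r n γ
  forward _ (inj₁ (μ , row , refl)) = Rows-∷ʳ0 m r n μ row
  forward _ (inj₂ (μ , row , refl)) = Rows-map-suc m r n μ r≤1+m row
  backward : ∀ γ → Rows (suc m) r n γ → Dropped γ ⊎ Lowered γ
  backward γ row with Descending-positive⊎lastZero γ (proj₁ (proj₂ (proj₁ row)))
  ... | inj₁ (μ , refl) = inj₂ (μ , Rows-map-suc⁻ m r n μ row , refl)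
  ... | inj₂ (μ , refl) = inj₁ (μ , Rows-∷ʳ0⁻ m r n μ row , refl)
  disjoint : ∀ γ → Dropped γ → ¬ Lowered γ
  disjoint _ (μ , _ , refl) (μ′ , _ , eq) with ∈-map⁻ suc (subst (0 ∈_) (sym eq) (∈-++⁺ʳ μ (here refl)))
  ... | _ , _ , ()

ColumnShape : ℕ → ℕ → List ℕ → Set
ColumnShape m r β = Descending β × All (1 ≤_) β × All (_≤ m) β × Fits β r

Columns : ℕ → ℕ → ℕ → List ℕ → Set
Columns m r n β = ColumnShape m r β × sum β ≡ n

Columns-base : ∀ n β → Columns 0 0 n β → β ≡ [] × n ≡ 0
Columns-base n []      (_ , refl)                         = refl , refl
Columns-base n (x ∷ β) ((_ , 1≤x ∷ _ , x≤0 ∷ _ , _) , _) = ⊥-elim (ℕₚ.<⇒≱ 1≤x x≤0)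

Columns-[] : Columns 0 0 0 []
Columns-[] = ([] , [] , [] , tt) , refl

Columns-empty : ∀ m r n β → m < r → ¬ Columns m r n β
Columns-empty m (suc r) n (x ∷ β) (s≤s m≤r) ((_ , _ , x≤m ∷ _ , r<x , _) , _) =
  ℕₚ.<⇒≱ r<x (ℕₚ.≤-trans x≤m m≤r)

Columns-weaken : ∀ m r n β → Columns m r n β → Columns (suc m) r n β
Columns-weaken m r n β ((descending , positive , bounded , fits) , sum≡) =
  (descending , positive , All.map ℕₚ.m≤n⇒m≤1+n bounded , fits) , sum≡

Columns-strengthen : ∀ m r n x xs → x ≢ suc m → Columns (suc m) r n (x ∷ xs) → Columns m r n (x ∷ xs)
Columns-strengthen m r n x xs x≢1+m ((descending , positive , x≤1+m ∷ _ , fits) , sum≡) =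
  (descending , positive , x≤m ∷ All.map (λ y≤x → ℕₚ.≤-trans y≤x x≤m) (Descending-head descending) , fits) ,
  sum≡
  where x≤m = ℕₚ.≤-pred (ℕₚ.≤∧≢⇒< x≤1+m x≢1+m)

Columns-∷ : ∀ m r n μ → r ≤ suc m → Shifted-by Columns m r n μ → Columns (suc m) r n (suc m ∷ μ)
Columns-∷ m r n μ r≤1+m (1+m≤n , (descending , positive , bounded , fits) , sum≡) =
  (Descending-∷ bounded descending , s≤s z≤n ∷ positive , ℕₚ.≤-refl ∷ bounded ,
   Fits-∷ (suc m) μ r r≤1+m fits) ,
  trans (cong (_+_ (suc m)) sum≡) (ℕₚ.m+[n∸m]≡n 1+m≤n)

Columns-∷⁻ : ∀ m r n μ → Columns (suc m) r n (suc m ∷ μ) → Shifted-by Columns m r n μ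
Columns-∷⁻ m r n μ ((descending , _ ∷ positive , _ ∷ bounded , fits) , sum≡) =
  m+n≡o⇒m≤o (suc m) sum≡ ,
  (Linked.tail descending , positive , bounded , Fits-∷⁻ r fits) ,
  m+n≡o⇒n≡o∸m (suc m) sum≡
  where
  Fits-∷⁻ : ∀ r → Fits (suc m ∷ μ) r → Fits μ (r ∸ 1)
  Fits-∷⁻ zero    _          = tt
  Fits-∷⁻ (suc r) (_ , fits) = fits

-- Either no part equals m + 1, or the first part does and is dropped.
Columns-step : ∀ m r n {c₁ c₂} → r ≤ suc m → HasCard (Columns m r n) c₁ →
               HasCard (Shifted-by Columns m r n) c₂ → HasCard (Columns (suc m) r n) (c₁ + c₂)
Columns-step m r n r≤1+m card₁ card₂ = HasCard-resp forward backward
  (HasCard-⊎ card₁ (HasCard-image (suc m ∷_) (λ _ _ _ _ → ∷-injectiveʳ) card₂) disjoint)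
  where
  Headed : List ℕ → Set
  Headed β = Σ (List ℕ) λ μ → Shifted-by Columns m r n μ × suc m ∷ μ ≡ β
  forward : ∀ β → Columns m r n β ⊎ Headed β → Columns (suc m) r n β
  forward β (inj₁ column)              = Columns-weaken m r n β column
  forward _ (inj₂ (μ , column , refl)) = Columns-∷ m r n μ r≤1+m column
  backward : ∀ β → Columns (suc m) r n β → Columns m r n β ⊎ Headed β
  backward []       ((descending , positive , _ , fits) , sum≡) = inj₁ ((descending , positive , [] , fits) , sum≡)
  backward (x ∷ xs) column with x ≟ suc m
  ... | yes refl = inj₂ (xs , Columns-∷⁻ m r n xs column , refl)
  ... | no x≢1+m = inj₁ (Columns-strengthen m r n x xs x≢1+m column)
  disjoint : ∀ β → Columns m r n β → ¬ Headed β
  disjoint _ ((_ , _ , 1+m≤m ∷ _ , _) , _) (_ , _ , refl) = ℕₚ.1+n≰n 1+m≤m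

module RowCounting = CountingFamily Rows Rows-base Rows-[] Rows-empty Rows-step
module ColumnCounting = CountingFamily Columns Columns-base Columns-[] Columns-empty Columns-step

-- Cutting a partition along its Durfee triangle

-- The first a = length γ parts reach past column b + 1 by the parts of γ; the rest are β.
glue : ℕ → List ℕ → List ℕ → List ℕ
glue b γ β = map (_+_ (suc b)) γ ++ β

glue-Descending : ∀ a b γ β → RowShape a a γ → ColumnShape b b β → Descending (glue b γ β)
glue-Descending a b γ β (_ , descendingγ , _) (descendingβ , _ , bounded , _) =
  Descending-++ (Descending-map-+ (suc b) descendingγ) descendingβ (above γ)
  where
  above : ∀ γ → All (λ x → All (_≤ x) β) (map (_+_ (suc b)) γ)
  above []      = []
  above (y ∷ γ) = All.map (λ z≤b → ℕₚ.≤-trans z≤b (ℕₚ.≤-trans (ℕₚ.n≤1+n b) (ℕₚ.m≤m+n (suc b) y))) bounded ∷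
                  above γ

glue-positive : ∀ b γ β → All (1 ≤_) β → All (1 ≤_) (glue b γ β)
glue-positive b γ β positive = All.++⁺ (shifted γ) positive
  where
  shifted : ∀ γ → All (1 ≤_) (map (_+_ (suc b)) γ)
  shifted []      = []
  shifted (y ∷ γ) = s≤s z≤n ∷ shifted γ

glue-Fits : ∀ a b γ β → length γ ≡ a → Fits γ a → Fits β b → Fits (glue b γ β) (a + b)
glue-Fits _ b []      β refl _            fitsβ = fitsβ
glue-Fits _ b (y ∷ γ) β refl (a<y , fitsγ) fitsβ =
  s≤s (subst (length γ + b ≤_) (ℕₚ.+-comm y b) (ℕₚ.+-monoˡ-≤ b (ℕₚ.<⇒≤ a<y))) ,
  glue-Fits _ b γ β refl fitsγ fitsβ

glue-¬Fits : ∀ a b γ β → length γ ≡ a → All (_≤ b) β → ¬ Fits (glue b γ β) (suc (a + b))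
glue-¬Fits _ b []      (y ∷ β) refl (y≤b ∷ _) (b<y , _) = ℕₚ.<⇒≱ b<y y≤b
glue-¬Fits _ b (y ∷ γ) β       refl bounded   (_ , fits) = glue-¬Fits _ b γ β refl bounded fits

glue-DurfeeTriangleSize : ∀ a b γ β → RowShape a a γ → ColumnShape b b β →
                          DurfeeTriangleSize (glue b γ β) (a + b)
glue-DurfeeTriangleSize a b γ β (length≡ , _ , fitsγ) (_ , _ , bounded , fitsβ) =
  Fits⇒DurfeeTriangleSize (glue b γ β) (a + b) (glue-Fits a b γ β length≡ fitsγ fitsβ)
                          (glue-¬Fits a b γ β length≡ bounded)

sum-glue : ∀ b γ β → sum (glue b γ β) ≡ length γ * suc b + (sum γ + sum β)
sum-glue b γ β = begin
  sum (map (_+_ (suc b)) γ ++ β)                ≡⟨ sum-++ (map (_+_ (suc b)) γ) β ⟩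
  sum (map (_+_ (suc b)) γ) + sum β             ≡⟨ cong (_+ sum β) (sum-map-+ (suc b) γ) ⟩
  length γ * suc b + sum γ + sum β              ≡⟨ ℕₚ.+-assoc (length γ * suc b) (sum γ) (sum β) ⟩
  length γ * suc b + (sum γ + sum β)            ∎
  where open ≡-Reasoning

glue-injective : ∀ b γ γ′ β β′ → length γ ≡ length γ′ → glue b γ β ≡ glue b γ′ β′ → γ ≡ γ′ × β ≡ β′
glue-injective b []      []        β β′ _       eq = refl , eq
glue-injective b (y ∷ γ) (y′ ∷ γ′) β β′ length≡ eq
  with glue-injective b γ γ′ β β′ (ℕₚ.suc-injective length≡) (∷-injectiveʳ eq)
... | refl , refl = cong (_∷ γ) (ℕₚ.+-cancelˡ-≡ (suc b) y y′ (∷-injectiveˡ eq)) , refl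

protrudingRows : ℕ → List ℕ → ℕ
protrudingRows k []       = 0
protrudingRows k (x ∷ xs) = if x ≤ᵇ k then 0 else suc (protrudingRows (k ∸ 1) xs)

protrudingRows-glue : ∀ a b γ β → RowShape a a γ → All (_≤ b) β → protrudingRows (a + b) (glue b γ β) ≡ a
protrudingRows-glue _ b []      []      (refl , _) _         = refl
protrudingRows-glue _ b []      (y ∷ β) (refl , _) (y≤b ∷ _) rewrite ≤ᵇ-true y≤b = refl
protrudingRows-glue _ b (y ∷ γ) β       (refl , descending , a<y , fits) bounded
  rewrite ≤ᵇ-false (s≤s (subst (suc (length γ + b) ≤_) (ℕₚ.+-comm y b) (ℕₚ.+-monoˡ-≤ b a<y))) =
  cong suc (protrudingRows-glue (length γ) b γ β (refl , Linked.tail descending , fits) bounded)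

Cut : ℕ → ℕ → List ℕ → Set
Cut k a xs = Σ (List ℕ × List ℕ) λ (γ , β) →
  (RowShape a a γ × ColumnShape (k ∸ a) (k ∸ a) β) × glue (k ∸ a) γ β ≡ xs

Cut-∷ : ∀ k a x xs → suc k < x → Descending (x ∷ xs) → a ≤ k → Cut k a xs → Cut (suc k) (suc a) (x ∷ xs)
Cut-∷ k a x xs k<x descending a≤k ((γ , β) , ((refl , descendingγ , fitsγ) , columns) , refl) =
  ((x ∸ suc b) ∷ γ , β) , ((refl , descending′ γ descendingγ descending , a<x∸b , fitsγ) , columns) ,
  cong (_∷ glue b γ β) (ℕₚ.m+[n∸m]≡n b<x)
  where
  b = k ∸ length γ
  a+b≡k : length γ + b ≡ k
  a+b≡k = ℕₚ.m+[n∸m]≡n a≤k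
  b<x : suc b ≤ x
  b<x = ℕₚ.≤-trans (s≤s (subst (b ≤_) a+b≡k (ℕₚ.m≤n+m b (length γ)))) (ℕₚ.<⇒≤ k<x)
  a<x∸b : length γ < x ∸ suc b
  a<x∸b = subst (_≤ x ∸ suc b) (ℕₚ.m+n∸m≡n (suc b) (suc (length γ)))
            (ℕₚ.∸-monoˡ-≤ (suc b) (subst (_≤ x) (sym sum≡) k<x))
    where
    sum≡ : suc b + suc (length γ) ≡ suc (suc k)
    sum≡ = trans (cong suc (ℕₚ.+-suc b (length γ))) (cong (suc ∘ suc) (trans (ℕₚ.+-comm b (length γ)) a+b≡k))
  descending′ : ∀ γ → Descending γ → Descending (x ∷ glue b γ β) → Descending ((x ∸ suc b) ∷ γ)
  descending′ []      _ _                = [-]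
  descending′ (y ∷ γ) descendingγ (b+y≤x ∷ _) =
    ℕₚ.≤-trans (ℕₚ.≤-reflexive (sym (ℕₚ.m+n∸m≡n (suc b) y))) (ℕₚ.∸-monoˡ-≤ (suc b) b+y≤x) ∷ descendingγ

decompose : ∀ xs k → Descending xs → All (1 ≤_) xs → Fits xs k → ¬ Fits xs (suc k) →
            Σ ℕ λ a → a ≤ k × Cut k a xs
decompose []       zero    _          _              _            _     =
  0 , z≤n , ([] , []) , ((refl , [] , tt) , ([] , [] , [] , tt)) , refl
decompose (x ∷ xs) zero    _          (1≤x ∷ _)      _            ¬fits = ⊥-elim (¬fits (1≤x , tt))
decompose (x ∷ xs) (suc k) descending positive (k<x , fits) ¬fits with x ≤? suc k
... | yes x≤k = 0 , z≤n , ([] , x ∷ xs) , ((refl , [] , tt) , (descending , positive , bounded , k<x , fits)) , refl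
  where bounded = x≤k ∷ All.map (λ y≤x → ℕₚ.≤-trans y≤x x≤k) (Descending-head descending)
... | no x≰k =
  let k<x = ℕₚ.≰⇒> x≰k
      (a , a≤k , cut) = decompose xs k (Linked.tail descending) (All.tail positive) fits (¬fits ∘ (k<x ,_))
  in suc a , s≤s a≤k , Cut-∷ k a x xs k<x descending a≤k cut

-- Counting partitions by their Durfee triangle

open RowCounting using () renaming (count to rowCount; count-HasCard to rowCount-HasCard;
  generatingFunction to rowSeries; Y-⊛-den to rowSeries-⊛-den)
open ColumnCounting using () renaming (count to columnCount; count-HasCard to columnCount-HasCard;
  generatingFunction to columnSeries; Y-⊛-den to columnSeries-⊛-den)

blockSize : ℕ → ℕ → ℕ
blockSize k a = a * suc (k ∸ a)

CutPair : ℕ → ℕ → ℕ → List ℕ × List ℕ → Set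
CutPair k n a (γ , β) = (RowShape a a γ × ColumnShape (k ∸ a) (k ∸ a) β) × blockSize k a + (sum γ + sum β) ≡ n

cutCount : ℕ → ℕ → ℕ → ℕ
cutCount k a n = if n <ᵇ blockSize k a then 0 else
  sumToℕ (n ∸ blockSize k a) (λ j → rowCount a a j * columnCount (k ∸ a) (k ∸ a) (n ∸ blockSize k a ∸ j))

CutPair-HasCard : ∀ k n a → HasCard (CutPair k n a) (cutCount k a n)
CutPair-HasCard k n a with n <? blockSize k a
... | yes n<t rewrite <ᵇ-true n<t = HasCard-empty (λ _ (_ , n≡) → ℕₚ.<⇒≱ n<t (m+n≡o⇒m≤o (blockSize k a) n≡))
... | no n≮t rewrite <ᵇ-false (ℕₚ.≮⇒≥ n≮t) = HasCard-resp
  (λ _ (rows , columns , sum≡) →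
     (rows , columns) , trans (cong (_+_ (blockSize k a)) sum≡) (ℕₚ.m+[n∸m]≡n (ℕₚ.≮⇒≥ n≮t)))
  (λ _ ((rows , columns) , n≡) → rows , columns , m+n≡o⇒n≡o∸m (blockSize k a) n≡)
  (HasCard-convolution sum sum (rowCount a a) (columnCount (k ∸ a) (k ∸ a))
    (rowCount-HasCard a a) (columnCount-HasCard (k ∸ a) (k ∸ a)) (n ∸ blockSize k a))

GluedCut : ℕ → ℕ → ℕ → List ℕ → Set
GluedCut k n a xs = Σ (List ℕ × List ℕ) λ (γ , β) → CutPair k n a (γ , β) × glue (k ∸ a) γ β ≡ xs

GluedCut-HasCard : ∀ k n a → HasCard (GluedCut k n a) (cutCount k a n)
GluedCut-HasCard k n a = HasCard-image (λ (γ , β) → glue (k ∸ a) γ β) injective (CutPair-HasCard k n a)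
  where
  injective : ∀ p p′ → CutPair k n a p → CutPair k n a p′ →
              glue (k ∸ a) (proj₁ p) (proj₂ p) ≡ glue (k ∸ a) (proj₁ p′) (proj₂ p′) → p ≡ p′
  injective (γ , β) (γ′ , β′) (((length≡ , _) , _) , _) (((length≡′ , _) , _) , _) glued
    with glue-injective (k ∸ a) γ γ′ β β′ (trans length≡ (sym length≡′)) glued
  ... | refl , refl = refl

GluedCut-index : ∀ k n a xs → a ≤ k → GluedCut k n a xs → protrudingRows k xs ≡ a
GluedCut-index k n a _ a≤k ((γ , β) , ((rows , (_ , _ , bounded , _)) , _) , refl) =
  trans (cong (λ l → protrudingRows l (glue (k ∸ a) γ β)) (sym (ℕₚ.m+[n∸m]≡n a≤k)))
        (protrudingRows-glue a (k ∸ a) γ β rows bounded)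

GluedCut-partition : ∀ k n a xs → a ≤ k → GluedCut k n a xs → IsPartition n xs × DurfeeTriangleSize xs k
GluedCut-partition k n a _ a≤k ((γ , β) , ((rows@(length≡ , _) , columns@(_ , positive , _)) , weight) , refl) =
  (glue-Descending a b γ β rows columns , glue-positive b γ β positive ,
   trans (sum-glue b γ β) (trans (cong (λ l → l * suc b + (sum γ + sum β)) length≡) weight)) ,
  subst (DurfeeTriangleSize (glue b γ β)) (ℕₚ.m+[n∸m]≡n a≤k) (glue-DurfeeTriangleSize a b γ β rows columns)
  where b = k ∸ a

partition-GluedCut : ∀ k n xs → IsPartition n xs × DurfeeTriangleSize xs k →
                     Σ ℕ λ a → a ≤ k × GluedCut k n a xs
partition-GluedCut k n xs ((descending , positive , sum≡) , durfee) =
  let (fits , ¬fits) = DurfeeTriangleSize⇒Fits xs k durfee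
      (a , a≤k , (γ , β) , (shape@((length≡ , _) , _) , glued)) = decompose xs k descending positive fits ¬fits
  in a , a≤k , (γ , β) , (shape , weight a γ β length≡ glued) , glued
  where
  weight : ∀ a γ β → length γ ≡ a → glue (k ∸ a) γ β ≡ xs → blockSize k a + (sum γ + sum β) ≡ n
  weight a γ β refl refl = trans (sym (sum-glue (k ∸ a) γ β)) sum≡

durfee-HasCard : ∀ k n → HasCard (λ xs → IsPartition n xs × DurfeeTriangleSize xs k)
                                 (sumToℕ k (λ a → cutCount k a n))
durfee-HasCard k n = HasCard-resp
  (λ xs (a , a≤k , cut) → GluedCut-partition k n a xs a≤k cut)
  (partition-GluedCut k n)
  (HasCard-⋃ k (GluedCut k n) (λ a → cutCount k a n) (λ a _ → GluedCut-HasCard k n a)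
    (λ a a′ xs a≤k a′≤k cut cut′ →
       trans (sym (GluedCut-index k n a xs a≤k cut)) (GluedCut-index k n a′ xs a′≤k cut′)))

+cutCount : ∀ k a n → + cutCount k a n ≡ shift (blockSize k a) (rowSeries a a ⊛ columnSeries (k ∸ a) (k ∸ a)) n
+cutCount k a n with n <ᵇ blockSize k a
... | true  = refl
... | false = trans (+-sumToℕ (n ∸ blockSize k a) _)
                    (sumTo-cong (n ∸ blockSize k a) (λ j → ℤₚ.pos-* (rowCount a a j) _))

durfee-generatingFunction : ∀ k (R : ℕ → ℕ) →
  (∀ n → HasCard (λ xs → IsPartition n xs × DurfeeTriangleSize xs k) (R n)) →
  (λ n → + R n) ≗ sumSeries k (λ a → shift (blockSize k a) (rowSeries a a ⊛ columnSeries (k ∸ a) (k ∸ a)))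
durfee-generatingFunction k R card n = begin
  + R n                                  ≡⟨ cong +_ (HasCard-unique (card n) (durfee-HasCard k n)) ⟩
  + sumToℕ k (λ a → cutCount k a n)      ≡⟨ +-sumToℕ k _ ⟩
  sumTo k (λ a → + cutCount k a n)       ≡⟨ sumTo-cong k (λ a → +cutCount k a n) ⟩
  sumSeries k (λ a → shift (blockSize k a) (rowSeries a a ⊛ columnSeries (k ∸ a) (k ∸ a))) n ∎
  where open ≡-Reasoning

-- The numerator φ

summand : ℕ → ℕ → Series
summand a b = (numerator a a ⊛ numerator b b) ⊛ gaussian a b

durfeeNumerator : ℕ → Series
durfeeNumerator k = sumSeries k (λ a → shift a (summand a (k ∸ a)))

rows⊛columns⊛den : ∀ a b → (rowSeries a a ⊛ columnSeries b b) ⊛ den (a + b) ≗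
                           shift (triangular a + triangular b) (summand a b)
rows⊛columns⊛den a b = begin
  (rowSeries a a ⊛ columnSeries b b) ⊛ den (a + b)
    ≈⟨ ⊛-congˡ (rowSeries a a ⊛ columnSeries b b) (den-⊛-gaussian a b) ⟨
  (rowSeries a a ⊛ columnSeries b b) ⊛ ((den a ⊛ den b) ⊛ gaussian a b)
    ≈⟨ ⊛-assoc (rowSeries a a ⊛ columnSeries b b) (den a ⊛ den b) (gaussian a b) ⟨
  ((rowSeries a a ⊛ columnSeries b b) ⊛ (den a ⊛ den b)) ⊛ gaussian a b
    ≈⟨ ⊛-congʳ (gaussian a b) (interchange (rowSeries a a) (columnSeries b b) (den a) (den b)) ⟩
  ((rowSeries a a ⊛ den a) ⊛ (columnSeries b b ⊛ den b)) ⊛ gaussian a b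
    ≈⟨ ⊛-congʳ (gaussian a b) (⊛-cong (rowSeries-⊛-den a a ℕₚ.≤-refl) (columnSeries-⊛-den b b ℕₚ.≤-refl)) ⟩
  (shift (triangular a) (numerator a a) ⊛ shift (triangular b) (numerator b b)) ⊛ gaussian a b
    ≈⟨ ⊛-congʳ (gaussian a b) (shift-⊛-shift (triangular a) (triangular b) (numerator a a) (numerator b b)) ⟩
  shift (triangular a + triangular b) (numerator a a ⊛ numerator b b) ⊛ gaussian a b
    ≈⟨ shift-⊛ (triangular a + triangular b) (numerator a a ⊛ numerator b b) (gaussian a b) ⟩
  shift (triangular a + triangular b) (summand a b)
    ∎
  where
  open ≗-Reasoning
  open ⊛-Properties using (interchange)

block-⊛-den : ∀ k a → a ≤ k →
  shift (blockSize k a) (rowSeries a a ⊛ columnSeries (k ∸ a) (k ∸ a)) ⊛ den k ≗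
  shift (triangular k) (shift a (summand a (k ∸ a)))
block-⊛-den k a a≤k = begin
  shift (a * suc b) (rowSeries a a ⊛ columnSeries b b) ⊛ den k
    ≈⟨ shift-⊛ (a * suc b) (rowSeries a a ⊛ columnSeries b b) (den k) ⟩
  shift (a * suc b) ((rowSeries a a ⊛ columnSeries b b) ⊛ den k)
    ≡⟨ cong (λ l → shift (a * suc b) ((rowSeries a a ⊛ columnSeries b b) ⊛ den l)) a+b≡k ⟨
  shift (a * suc b) ((rowSeries a a ⊛ columnSeries b b) ⊛ den (a + b))
    ≈⟨ shift-cong (a * suc b) (rows⊛columns⊛den a b) ⟩
  shift (a * suc b) (shift (triangular a + triangular b) (summand a b))
    ≈⟨ shift-shift (a * suc b) (triangular a + triangular b) (summand a b) ⟩
  shift (a * suc b + (triangular a + triangular b)) (summand a b)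
    ≡⟨ cong (λ t → shift t (summand a b)) exponent ⟩
  shift (triangular k + a) (summand a b)
    ≈⟨ shift-shift (triangular k) a (summand a b) ⟨
  shift (triangular k) (shift a (summand a b))
    ∎
  where
  open ≗-Reasoning
  b = k ∸ a
  a+b≡k = ℕₚ.m+[n∸m]≡n a≤k
  exponent : a * suc b + (triangular a + triangular b) ≡ triangular k + a
  exponent = trans (rearrange a b (triangular a) (triangular b))
                   (cong (_+ a) (trans (sym (triangular-+ a b)) (cong triangular a+b≡k)))
    where
    rearrange : ∀ a b x y → a * suc b + (x + y) ≡ x + y + a * b + a
    rearrange = ℕ-Solver.solve-∀

durfee-⊛-den : ∀ k (R : ℕ → ℕ) →
  (∀ n → HasCard (λ xs → IsPartition n xs × DurfeeTriangleSize xs k) (R n)) →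
  (λ n → + R n) ⊛ den k ≗ shift (triangular k) (durfeeNumerator k)
durfee-⊛-den k R card = begin
  (λ n → + R n) ⊛ den k
    ≈⟨ ⊛-congʳ (den k) (durfee-generatingFunction k R card) ⟩
  sumSeries k block ⊛ den k
    ≈⟨ sumSeries-⊛ k block (den k) ⟩
  sumSeries k (λ a → block a ⊛ den k)
    ≈⟨ sumSeries-cong≤ k (block-⊛-den k) ⟩
  sumSeries k (λ a → shift (triangular k) (shift a (summand a (k ∸ a))))
    ≈⟨ shift-sumSeries (triangular k) k (λ a → shift a (summand a (k ∸ a))) ⟨
  shift (triangular k) (durfeeNumerator k)
    ∎
  where
  open ≗-Reasoning
  block : ℕ → Series
  block a = shift (blockSize k a) (rowSeries a a ⊛ columnSeries (k ∸ a) (k ∸ a))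

gaussian-constant : ∀ a b → gaussian a b 0 ≡ 1ℤ
gaussian-constant zero    b       = refl
gaussian-constant (suc a) zero    = refl
gaussian-constant (suc a) (suc b) = cong (_+ℤ 0ℤ) (gaussian-constant a (suc b))

summand-constant : ∀ a b → summand a b 0 ≡ 1ℤ
summand-constant a b = cong₂ _*ℤ_
  (cong₂ _*ℤ_ (numerator-constant a a ℕₚ.≤-refl) (numerator-constant b b ℕₚ.≤-refl)) (gaussian-constant a b)

summand-zeroʳ : ∀ a → summand a 0 ≗ numerator a a
summand-zeroʳ a = begin
  (numerator a a ⊛ oneS) ⊛ gaussian a 0   ≡⟨ cong ((numerator a a ⊛ oneS) ⊛_) (gaussian-zeroʳ a) ⟩
  (numerator a a ⊛ oneS) ⊛ oneS           ≈⟨ ⊛-identityʳ (numerator a a ⊛ oneS) ⟩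
  numerator a a ⊛ oneS                    ≈⟨ ⊛-identityʳ (numerator a a) ⟩
  numerator a a                           ∎
  where open ≗-Reasoning

summand-sym : ∀ a b → summand b a ≗ summand a b
summand-sym a b = ⊛-cong (⊛-comm (numerator b b) (numerator a a)) (gaussian-sym b a)

summandDegree : ℕ → ℕ → ℕ
summandDegree a b = a * (a ∸ 1) + b * (b ∸ 1) + a * b

summand-degree : ∀ a b → DegreeAtMost (summand a b) (summandDegree a b)
summand-degree a b =
  DegreeAtMost-⊛ (DegreeAtMost-⊛ (proj₁ (numerator-diagonal a)) (proj₁ (numerator-diagonal b))) (gaussian-degree a b)

summandDegree-sym : ∀ a b → summandDegree b a ≡ summandDegree a b
summandDegree-sym a b = rearrange a b (a * (a ∸ 1)) (b * (b ∸ 1))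
  where
  rearrange : ∀ a b x y → y + x + b * a ≡ x + y + a * b
  rearrange = ℕ-Solver.solve-∀

n+n*[n∸1]≡n*n : ∀ n → n + n * (n ∸ 1) ≡ n * n
n+n*[n∸1]≡n*n zero    = refl
n+n*[n∸1]≡n*n (suc n) = sym (ℕₚ.*-suc (suc n) n)

-- The summand of index a has degree a + summandDegree a b ≤ (a + b)², with equality only for b = 0.
summandDegree-square : ∀ a b → a + summandDegree a b + b * suc a ≡ (a + b) * (a + b)
summandDegree-square a b = begin
  a + (a * (a ∸ 1) + b * (b ∸ 1) + a * b) + b * suc a
    ≡⟨ rearrange a b (a * (a ∸ 1)) (b * (b ∸ 1)) ⟩
  (a + a * (a ∸ 1)) + (b + b * (b ∸ 1)) + 2 * (a * b)
    ≡⟨ cong₂ (λ x y → x + y + 2 * (a * b)) (n+n*[n∸1]≡n*n a) (n+n*[n∸1]≡n*n b) ⟩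
  a * a + b * b + 2 * (a * b)
    ≡⟨ expand a b ⟩
  (a + b) * (a + b)
    ∎
  where
  open ≡-Reasoning
  rearrange : ∀ a b x y → a + (x + y + a * b) + b * suc a ≡ (a + x) + (b + y) + 2 * (a * b)
  rearrange = ℕ-Solver.solve-∀
  expand : ∀ a b → a * a + b * b + 2 * (a * b) ≡ (a + b) * (a + b)
  expand = ℕ-Solver.solve-∀

term-degree-≤ : ∀ k a → a ≤ k → a + summandDegree a (k ∸ a) ≤ k * k
term-degree-≤ k a a≤k = subst (a + summandDegree a (k ∸ a) ≤_) square (ℕₚ.m≤m+n _ _)
  where square = trans (summandDegree-square a (k ∸ a)) (cong (λ l → l * l) (ℕₚ.m+[n∸m]≡n a≤k))

term-degree-< : ∀ k a → a < k → a + summandDegree a (k ∸ a) < k * k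
term-degree-< k a a<k = subst (a + summandDegree a (k ∸ a) <_) square (ℕₚ.m<m+n _ positive)
  where
  square = trans (summandDegree-square a (k ∸ a)) (cong (λ l → l * l) (ℕₚ.m+[n∸m]≡n (ℕₚ.<⇒≤ a<k)))
  positive : 0 < (k ∸ a) * suc a
  positive = ℕₚ.*-mono-< (ℕₚ.m<n⇒0<n∸m a<k) (s≤s z≤n)

term-degree : ∀ k a → DegreeAtMost (shift a (summand a (k ∸ a))) (a + summandDegree a (k ∸ a))
term-degree k a = DegreeAtMost-shift a (summand-degree a (k ∸ a))

durfeeNumerator-constant : ∀ k → durfeeNumerator k 0 ≡ 1ℤ
durfeeNumerator-constant k = trans (sumTo-single k 0 _ z≤n shifted) (summand-constant 0 k)
  where
  shifted : ∀ a → a ≤ k → a ≢ 0 → shift a (summand a (k ∸ a)) 0 ≡ 0ℤ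
  shifted zero    _ a≢0 = ⊥-elim (a≢0 refl)
  shifted (suc a) _ _   = refl

durfeeNumerator-degree : ∀ k i → k * k < i → durfeeNumerator k i ≡ 0ℤ
durfeeNumerator-degree k i k²<i =
  sumTo-zero k _ (λ a a≤k → term-degree k a i (ℕₚ.≤-<-trans (term-degree-≤ k a a≤k) k²<i))

durfeeNumerator-top : ∀ k → durfeeNumerator k (k * k) ≡ -1ℤ ^ (k ∸ 1)
durfeeNumerator-top k = begin
  durfeeNumerator k (k * k)
    ≡⟨ sumTo-single k k _ ℕₚ.≤-refl
         (λ a a≤k a≢k → term-degree k a (k * k) (term-degree-< k a (ℕₚ.≤∧≢⇒< a≤k a≢k))) ⟩
  shift k (summand k (k ∸ k)) (k * k)
    ≡⟨ cong₂ (λ b i → shift k (summand k b) i) (ℕₚ.n∸n≡0 k) (sym (n+n*[n∸1]≡n*n k)) ⟩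
  shift k (summand k 0) (k + k * (k ∸ 1))
    ≡⟨ shift-+ k (summand k 0) (k * (k ∸ 1)) ⟩
  summand k 0 (k * (k ∸ 1))
    ≡⟨ summand-zeroʳ k (k * (k ∸ 1)) ⟩
  numerator k k (k * (k ∸ 1))
    ≡⟨ proj₂ (numerator-diagonal k) ⟩
  -1ℤ ^ (k ∸ 1)
    ∎
  where open ≡-Reasoning

-- Evaluation at q = -1

alternatingSum : ℕ → Series → ℤ
alternatingSum N f = sumTo N (λ i → f i *ℤ (-1ℤ ^ i))

alternatingSum-cong : ∀ N {f g} → f ≗ g → alternatingSum N f ≡ alternatingSum N g
alternatingSum-cong N f≗g = sumTo-cong N (λ i → cong (_*ℤ (-1ℤ ^ i)) (f≗g i))

alternatingSum-sumSeries : ∀ N k F →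
                           alternatingSum N (sumSeries k F) ≡ sumTo k (λ a → alternatingSum N (F a))
alternatingSum-sumSeries N k F = trans (sumTo-cong N (λ i → sumTo-*ʳ k (-1ℤ ^ i) (λ a → F a i)))
                                       (sumTo-comm N k (λ a i → F a i *ℤ (-1ℤ ^ i)))

alternatingSum-degree : ∀ {f d} N → DegreeAtMost f d → d ≤ N → alternatingSum N f ≡ alternatingSum d f
alternatingSum-degree {d = d} N deg d≤N =
  sumTo-dropFinal d N _ d≤N (λ i d<i → cong (_*ℤ (-1ℤ ^ i)) (deg i d<i))

alternatingSum-shift : ∀ a N f → a ≤ N → alternatingSum N (shift a f) ≡ (-1ℤ ^ a) *ℤ alternatingSum (N ∸ a) f
alternatingSum-shift a N f a≤N = begin
  alternatingSum N (shift a f)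
    ≡⟨ cong (λ M → alternatingSum M (shift a f)) (ℕₚ.m+[n∸m]≡n a≤N) ⟨
  alternatingSum (a + (N ∸ a)) (shift a f)
    ≡⟨ sumTo-dropInitial a (N ∸ a) _ (λ i i<a → cong (_*ℤ (-1ℤ ^ i)) (shift-< a f i<a)) ⟩
  sumTo (N ∸ a) (λ i → shift a f (a + i) *ℤ (-1ℤ ^ (a + i)))
    ≡⟨ sumTo-cong (N ∸ a) (λ i → cong₂ _*ℤ_ (shift-+ a f i) (ℤₚ.^-distribˡ-+-* -1ℤ a i)) ⟩
  sumTo (N ∸ a) (λ i → f i *ℤ ((-1ℤ ^ a) *ℤ (-1ℤ ^ i)))
    ≡⟨ sumTo-cong (N ∸ a) (λ i → x∙yz≈y∙xz (f i) (-1ℤ ^ a) (-1ℤ ^ i)) ⟩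
  sumTo (N ∸ a) (λ i → (-1ℤ ^ a) *ℤ (f i *ℤ (-1ℤ ^ i)))
    ≡⟨ sumTo-*ˡ (N ∸ a) (-1ℤ ^ a) (λ i → f i *ℤ (-1ℤ ^ i)) ⟨
  (-1ℤ ^ a) *ℤ alternatingSum (N ∸ a) f
    ∎
  where
  open ≡-Reasoning
  open CommutativeSemigroupProperties ℤₚ.*-commutativeSemigroup using (x∙yz≈y∙xz)

-1^-square : ∀ a → (-1ℤ ^ a) *ℤ (-1ℤ ^ a) ≡ 1ℤ
-1^-square zero    = refl
-1^-square (suc a) = trans (signs (-1ℤ ^ a)) (-1^-square a)
  where
  signs : ∀ x → (-1ℤ *ℤ x) *ℤ (-1ℤ *ℤ x) ≡ x *ℤ x
  signs = solve-∀

-1^-odd : ∀ k → k % 2 ≡ 1 → -1ℤ ^ k ≡ -1ℤ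
-1^-odd k odd = begin
  -1ℤ ^ k
    ≡⟨ cong (-1ℤ ^_) (trans (ℕ-DivMod.m≡m%n+[m/n]*n k 2) (cong (_+ k / 2 * 2) odd)) ⟩
  -1ℤ *ℤ (-1ℤ ^ (k / 2 * 2))           ≡⟨ cong (λ e → -1ℤ *ℤ (-1ℤ ^ e)) (ℕₚ.*-comm (k / 2) 2) ⟩
  -1ℤ *ℤ (-1ℤ ^ (2 * (k / 2)))         ≡⟨ cong (-1ℤ *ℤ_) (ℤₚ.^-*-assoc -1ℤ 2 (k / 2)) ⟨
  -1ℤ *ℤ ((-1ℤ ^ 2) ^ (k / 2))         ≡⟨ cong (-1ℤ *ℤ_) (ℤₚ.^-zeroˡ (k / 2)) ⟩
  -1ℤ                                  ∎
  where open ≡-Reasoning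

-1^-∸-odd : ∀ k a → k % 2 ≡ 1 → a ≤ k → -1ℤ ^ (k ∸ a) ≡ -ℤ (-1ℤ ^ a)
-1^-∸-odd k a odd a≤k = begin
  -1ℤ ^ (k ∸ a)                                    ≡⟨ ℤₚ.*-identityʳ _ ⟨
  (-1ℤ ^ (k ∸ a)) *ℤ 1ℤ                            ≡⟨ cong ((-1ℤ ^ (k ∸ a)) *ℤ_) (-1^-square a) ⟨
  (-1ℤ ^ (k ∸ a)) *ℤ ((-1ℤ ^ a) *ℤ (-1ℤ ^ a))      ≡⟨ ℤₚ.*-assoc (-1ℤ ^ (k ∸ a)) _ _ ⟨
  (-1ℤ ^ (k ∸ a)) *ℤ (-1ℤ ^ a) *ℤ (-1ℤ ^ a)        ≡⟨ cong (_*ℤ (-1ℤ ^ a)) (ℤₚ.^-distribˡ-+-* -1ℤ (k ∸ a) a) ⟨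
  (-1ℤ ^ (k ∸ a + a)) *ℤ (-1ℤ ^ a)                 ≡⟨ cong (λ e → (-1ℤ ^ e) *ℤ (-1ℤ ^ a)) (ℕₚ.m∸n+n≡m a≤k) ⟩
  (-1ℤ ^ k) *ℤ (-1ℤ ^ a)                           ≡⟨ cong (_*ℤ (-1ℤ ^ a)) (-1^-odd k odd) ⟩
  -1ℤ *ℤ (-1ℤ ^ a)                                 ≡⟨ ℤₚ.-1*i≡-i (-1ℤ ^ a) ⟩
  -ℤ (-1ℤ ^ a)                                     ∎
  where open ≡-Reasoning

x≡-x⇒x≡0 : ∀ {x} → x ≡ -ℤ x → x ≡ 0ℤ
x≡-x⇒x≡0 {+ zero} _ = refl

summandAtMinusOne : ℕ → ℕ → ℤ
summandAtMinusOne a b = alternatingSum (summandDegree a b) (summand a b)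

summandAtMinusOne-sym : ∀ a b → summandAtMinusOne b a ≡ summandAtMinusOne a b
summandAtMinusOne-sym a b = trans (cong (λ d → alternatingSum d (summand b a)) (summandDegree-sym a b))
                                  (alternatingSum-cong (summandDegree a b) (summand-sym a b))

durfeeNumerator-alternatingSum : ∀ k →
  alternatingSum (k * k) (durfeeNumerator k) ≡ sumTo k (λ a → (-1ℤ ^ a) *ℤ summandAtMinusOne a (k ∸ a))
durfeeNumerator-alternatingSum k =
  trans (alternatingSum-sumSeries (k * k) k _) (sumTo-cong≤ k term)
  where
  term : ∀ a → a ≤ k →
         alternatingSum (k * k) (shift a (summand a (k ∸ a))) ≡ (-1ℤ ^ a) *ℤ summandAtMinusOne a (k ∸ a)
  term a a≤k = trans (alternatingSum-shift a (k * k) (summand a (k ∸ a))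
                                           (ℕₚ.≤-trans (ℕₚ.m≤m+n a _) (term-degree-≤ k a a≤k)))
    (cong ((-1ℤ ^ a) *ℤ_) (alternatingSum-degree (k * k ∸ a) (summand-degree a (k ∸ a)) degree≤))
    where
    degree≤ : summandDegree a (k ∸ a) ≤ k * k ∸ a
    degree≤ = subst (_≤ k * k ∸ a) (ℕₚ.m+n∸m≡n a _) (ℕₚ.∸-monoˡ-≤ a (term-degree-≤ k a a≤k))

-- For odd k the summands of index a and k - a cancel at q = -1.
durfeeNumerator-odd : ∀ k → k % 2 ≡ 1 → alternatingSum (k * k) (durfeeNumerator k) ≡ 0ℤ
durfeeNumerator-odd k odd = trans (durfeeNumerator-alternatingSum k) (x≡-x⇒x≡0 (begin
  sumTo k term                                                 ≡⟨ sumTo-reverse k term ⟩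
  sumTo k (λ a → term (k ∸ a))                                 ≡⟨ sumTo-cong≤ k paired ⟩
  sumTo k (λ a → -ℤ term a)                                    ≡⟨ sumTo-neg k term ⟨
  -ℤ sumTo k term                                              ∎))
  where
  open ≡-Reasoning
  term : ℕ → ℤ
  term a = (-1ℤ ^ a) *ℤ summandAtMinusOne a (k ∸ a)
  paired : ∀ a → a ≤ k → term (k ∸ a) ≡ -ℤ term a
  paired a a≤k = begin
    (-1ℤ ^ (k ∸ a)) *ℤ summandAtMinusOne (k ∸ a) (k ∸ (k ∸ a))
      ≡⟨ cong₂ _*ℤ_ (-1^-∸-odd k a odd a≤k)
                    (trans (cong (summandAtMinusOne (k ∸ a)) (ℕₚ.m∸[m∸n]≡n a≤k)) (summandAtMinusOne-sym a (k ∸ a))) ⟩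
    -ℤ (-1ℤ ^ a) *ℤ summandAtMinusOne a (k ∸ a)
      ≡⟨ ℤₚ.neg-distribˡ-* (-1ℤ ^ a) _ ⟨
    -ℤ term a
      ∎

theorem1 : (k : ℕ) → 1 ≤ k → (R : ℕ → ℕ)
    → (∀ n → HasCard (λ (λs : List ℕ) → IsPartition n λs × DurfeeTriangleSize λs k) (R n))
    → Σ Series λ φ →
    (φ 0 ≡ 1ℤ)
    × (φ (k * k) ≡ -1ℤ ^ (k ∸ 1))
    × (∀ i → k * k < i → φ i ≡ 0ℤ)
    × (∀ n → ((λ m → + R m) ⊛ den k) n ≡ shift ((k * suc k) / 2) φ n)
    × (k % 2 ≡ 1 → sumTo (k * k) (λ i → φ i *ℤ (-1ℤ ^ i)) ≡ 0ℤ)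
theorem1 k _ R card =
  durfeeNumerator k ,
  durfeeNumerator-constant k ,
  durfeeNumerator-top k ,
  durfeeNumerator-degree k ,
  (λ n → trans (durfee-⊛-den k R card n) (cong (λ t → shift t (durfeeNumerator k) n) (sym (triangular-half k)))) ,
  durfeeNumerator-odd k
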